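{- Let $G$ be a finite simple graph embedded in a closed surface and let $\mathcal F\neq\mathcal F(G)$ be a set of even faces of $G$. Then the Zhang–Zhang polynomial $\mathbf{ZZ}_{\mathcal F}(G,x)$ of $G$ with respect to $\mathcal F$ equals the cube polynomial $\mathbf C(R(G;\mathcal F),x)$ of the resonance graph $R(G;\mathcal F)$.
   Context: A closed surface is a compact connected 2-dimensional manifold without boundary. A face of $G$ is the closure of a connected component of $\Sigma\setminus G$; $E(f)$ denotes the set of edges on the boundary of face $f$, and $\mathcal F(G)$ denotes the set of all faces of $G$. A face is even if its boundary is a cycle of even length. For a set $\mathcal F$ of even faces, the resonance graph $R(G;\mathcal F)$ has as vertex set the set of all perfect matchings of $G$, and two perfect matchings $M_1,M_2$ are adjacent iff $M_1\oplus M_2=E(f)$ for some face $f\in\mathcal F$. A Clar cover of $G$ is a spanning subgraph $S$ of $G$ each of whose connected components is either a single edge or the boundary cycle of an even face. The Zhang–Zhang polynomial is $\mathbf{ZZ}_{\mathcal F}(G,x)=\sum_{k\ge0} z_k(G,\mathcal F)x^k$, where $z_k(G,\mathcal F)$ is the number of Clar covers of $G$ having exactly $k$ face-boundary components, all of which are boundaries of faces in $\mathcal F$. The cube polynomial of a graph $H$ is $\mathbf C(H,x)=\sum_{i\ge0}\alpha_i(H)x^i$, where $\alpha_i(H)$ is the number of induced subgraphs of $H$ isomorphic to the $i$-dimensional hypercube $Q_i$ ($Q_0$ being the one-vertex graph). -}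

module Defs where

open import Data.Nat using (ℕ; zero; suc; _≤_; _<_)
open import Data.Nat.Divisibility using (_∣_)
open import Data.Fin using (Fin; toℕ)
open import Data.Fin.Subset using (Subset; _∈_; _∉_; _⊆_; ∣_∣; ⊤)
open import Data.Bool using (Bool; true; false)
open import Data.Vec using (Vec; []; _∷_)
open import Data.Product using (Σ; ∃; ∃-syntax; _×_; _,_)
open import Data.Sum using (_⊎_)
open import Data.Empty using (⊥)
open import Relation.Nullary using (¬_)
open import Relation.Binary.PropositionalEquality using (_≡_; _≢_)
open import Relation.Binary.Construct.Closure.ReflexiveTransitive using (Star)
open import Function.Definitions using (Injective)
open import Function.Bundles using (_⇔_; _↔_)
open import Data.Refinement using (Refinement)

-- Combinatorial description of a finite graph embedded in a closed
-- surface (arbitrary, not necessarily cellular, embedding).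
--
-- Flags (Fin nX) with the three fixed-point-free involutions τ₀ (vertex
-- changing), τ₁ (edge changing), τ₂ (face/side changing) describe the
-- regular neighbourhood (ribbon graph) of the non-isolated part of G,
-- i.e. a generalized rotation system, possibly of a disconnected graph.
--   vertex of a flag  = its ⟨τ₁,τ₂⟩-orbit  (labelled by vtx),
--   edge of a flag    = its ⟨τ₀,τ₂⟩-orbit  (labelled by edg),
--   boundary walks    = ⟨τ₀,τ₁⟩-orbits.
-- A face of Σ∖G (closure of a component) is a surface whose boundary
-- circles are some of these boundary walks (fac assigns each flag its
-- face), possibly also containing isolated vertices (isoFace).
-- Connectedness of Σ is the connectivity of the incidence structure.

Steps : ∀ {n} → (Fin n → Fin n) → (Fin n → Fin n) → Fin n → Fin n → Set
Steps σ ρ x y = (y ≡ σ x) ⊎ (y ≡ ρ x)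

Orbit : ∀ {n} → (Fin n → Fin n) → (Fin n → Fin n) → Fin n → Fin n → Set
Orbit σ ρ = Star (Steps σ ρ)

data Node (nX nV nF : ℕ) : Set where
  flagN : Fin nX → Node nX nV nF
  vertN : Fin nV → Node nX nV nF
  faceN : Fin nF → Node nX nV nF

data Link₀ {nX nV nF : ℕ} (τ₀ τ₁ τ₂ : Fin nX → Fin nX) (vtx : Fin nX → Fin nV)
           (fac : Fin nX → Fin nF) (isoFace : Fin nV → Fin nF)
           : Node nX nV nF → Node nX nV nF → Set where
  l-τ₀ : ∀ x → Link₀ τ₀ τ₁ τ₂ vtx fac isoFace (flagN x) (flagN (τ₀ x))
  l-τ₁ : ∀ x → Link₀ τ₀ τ₁ τ₂ vtx fac isoFace (flagN x) (flagN (τ₁ x))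
  l-τ₂ : ∀ x → Link₀ τ₀ τ₁ τ₂ vtx fac isoFace (flagN x) (flagN (τ₂ x))
  l-vtx : ∀ x → Link₀ τ₀ τ₁ τ₂ vtx fac isoFace (flagN x) (vertN (vtx x))
  l-fac : ∀ x → Link₀ τ₀ τ₁ τ₂ vtx fac isoFace (flagN x) (faceN (fac x))
  l-iso : ∀ v → ¬ (∃[ x ] vtx x ≡ v) → Link₀ τ₀ τ₁ τ₂ vtx fac isoFace (vertN v) (faceN (isoFace v))

Link : {nX nV nF : ℕ} (τ₀ τ₁ τ₂ : Fin nX → Fin nX) (vtx : Fin nX → Fin nV)
       (fac : Fin nX → Fin nF) (isoFace : Fin nV → Fin nF)
       → Node nX nV nF → Node nX nV nF → Set
Link τ₀ τ₁ τ₂ vtx fac isoFace a b =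
  Link₀ τ₀ τ₁ τ₂ vtx fac isoFace a b ⊎ Link₀ τ₀ τ₁ τ₂ vtx fac isoFace b a

record EmbeddedGraph : Set₁ where
  field
    nV nE nF nX : ℕ
    τ₀ τ₁ τ₂ : Fin nX → Fin nX
    vtx : Fin nX → Fin nV
    edg : Fin nX → Fin nE
    fac : Fin nX → Fin nF
    isoFace : Fin nV → Fin nF
    τ₀-inv : ∀ x → τ₀ (τ₀ x) ≡ x
    τ₁-inv : ∀ x → τ₁ (τ₁ x) ≡ x
    τ₂-inv : ∀ x → τ₂ (τ₂ x) ≡ x
    τ₀-fpf : ∀ x → τ₀ x ≢ x
    τ₁-fpf : ∀ x → τ₁ x ≢ x
    τ₂-fpf : ∀ x → τ₂ x ≢ x
    τ₀τ₂-comm : ∀ x → τ₀ (τ₂ x) ≡ τ₂ (τ₀ x)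
    τ₀τ₂-fpf : ∀ x → τ₀ (τ₂ x) ≢ x
    vtx-orbit : ∀ x y → (vtx x ≡ vtx y) ⇔ Orbit τ₁ τ₂ x y
    edg-orbit : ∀ x y → (edg x ≡ edg y) ⇔ Orbit τ₀ τ₂ x y
    edg-surj : ∀ e → ∃[ x ] edg x ≡ e
    fac-τ₀ : ∀ x → fac (τ₀ x) ≡ fac x
    fac-τ₁ : ∀ x → fac (τ₁ x) ≡ fac x
    -- Σ∖G is nonempty
    someFace : Fin nF
    no-loop : ∀ x → vtx (τ₀ x) ≢ vtx x
    no-parallel : ∀ x y → vtx x ≡ vtx y → vtx (τ₀ x) ≡ vtx (τ₀ y) → edg x ≡ edg y
    connected : ∀ a b → Star (Link τ₀ τ₁ τ₂ vtx fac isoFace) a b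

module _ (G : EmbeddedGraph) where
  open EmbeddedGraph G

  Isolated : Fin nV → Set
  Isolated v = ¬ (∃[ x ] vtx x ≡ v)

  Inc : Fin nE → Fin nV → Set
  Inc e v = ∃[ x ] (edg x ≡ e × vtx x ≡ v)

  Joins : Fin nE → Fin nV → Fin nV → Set
  Joins e u v = Inc e u × Inc e v × u ≢ v

  OnFace : Fin nF → Fin nE → Set
  OnFace f e = ∃[ x ] (edg x ≡ e × fac x ≡ f)

  VOnFace : Fin nF → Fin nV → Set
  VOnFace f v = (∃[ x ] (vtx x ≡ v × fac x ≡ f)) ⊎ (Isolated v × isoFace v ≡ f)

  Consec : ∀ {L} → Fin (suc L) → Fin (suc L) → Set
  Consec {L} i j = (suc (toℕ i) ≡ toℕ j) ⊎ (toℕ i ≡ L × toℕ j ≡ 0)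

  EvenFace : Fin nF → Set
  EvenFace f =
    ∃[ L ] (2 ≤ L × 2 ∣ suc L ×
      Σ (Fin (suc L) → Fin nV) λ c →
        Injective _≡_ _≡_ c ×
        (∀ v → VOnFace f v ⇔ (∃[ i ] c i ≡ v)) ×
        (∀ i j → Consec i j → ∃[ e ] (OnFace f e × Joins e (c i) (c j))) ×
        (∀ e → OnFace f e ⇔ (∃[ i ] ∃[ j ] (Consec i j × Joins e (c i) (c j)))))

  PerfectMatching : Subset nE → Set
  PerfectMatching M =
    ∀ v → ∃[ e ] (e ∈ M × Inc e v × (∀ e′ → e′ ∈ M → Inc e′ v → e′ ≡ e))

  SymDiff : Subset nE → Subset nE → Fin nE → Set
  SymDiff M₁ M₂ e = (e ∈ M₁ × e ∉ M₂) ⊎ (e ∉ M₁ × e ∈ M₂)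

  ResAdj : Subset nF → Subset nE → Subset nE → Set
  ResAdj 𝓕 M₁ M₂ = ∃[ f ] (f ∈ 𝓕 × (∀ e → SymDiff M₁ M₂ e ⇔ OnFace f e))

  -- S is a Clar cover of G with exactly k face-boundary components, all
  -- of them boundaries of faces in 𝓕: S is the union of the boundaries
  -- of a set K ⊆ 𝓕 of k even faces with pairwise disjoint boundaries and
  -- a perfect matching M of the vertices not on these boundaries.
  ClarCover : Subset nF → ℕ → Subset nE → Set
  ClarCover 𝓕 k S =
    Σ (Subset nF) λ K → K ⊆ 𝓕 × ∣ K ∣ ≡ k ×
      (∀ f → f ∈ K → EvenFace f) ×
      (∀ f g → f ∈ K → g ∈ K → f ≢ g → ∀ v → VOnFace f v → VOnFace g v → ⊥) ×
      Σ (Subset nE) λ M →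
        (∀ e v → e ∈ M → Inc e v → ∀ f → f ∈ K → VOnFace f v → ⊥) ×
        (∀ v → (∃[ f ] (f ∈ K × VOnFace f v))
               ⊎ (∃[ e ] (e ∈ M × Inc e v × (∀ e′ → e′ ∈ M → Inc e′ v → e′ ≡ e)))) ×
        (∀ e → (e ∈ S) ⇔ ((e ∈ M) ⊎ (∃[ f ] (f ∈ K × OnFace f e))))

  -- the set of Clar covers counted by z_k(G,𝓕)
  ClarCovers : Subset nF → ℕ → Set
  ClarCovers 𝓕 k = Refinement (Subset nE) (ClarCover 𝓕 k)

-- Finite sets of edge subsets (sets of vertices of the resonance graph),
-- represented as binary tries so that equality is extensional.

SubsetFamily : ℕ → Set
SubsetFamily zero = Bool
SubsetFamily (suc n) = SubsetFamily n × SubsetFamily n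

-- membership: the first component collects subsets not containing the
-- first element, the second those containing it
_∈ᶠ_ : ∀ {n} → Subset n → SubsetFamily n → Set
_∈ᶠ_ {zero} [] b = b ≡ true
_∈ᶠ_ {suc n} (false ∷ S) (U₀ , U₁) = S ∈ᶠ U₀
_∈ᶠ_ {suc n} (true ∷ S) (U₀ , U₁) = S ∈ᶠ U₁

QAdj : ∀ {i} → Vec Bool i → Vec Bool i → Set
QAdj [] [] = ⊥
QAdj (a ∷ as) (b ∷ bs) = (a ≢ b × as ≡ bs) ⊎ (a ≡ b × QAdj as bs)

module _ (G : EmbeddedGraph) where
  open EmbeddedGraph G

  InducedCube : Subset nF → ℕ → SubsetFamily nE → Set
  InducedCube 𝓕 i U =
    (∀ M → M ∈ᶠ U → PerfectMatching G M) ×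
    Σ (Vec Bool i → Subset nE) λ φ →
      (∀ a → φ a ∈ᶠ U) ×
      (∀ M → M ∈ᶠ U → ∃[ a ] φ a ≡ M) ×
      Injective _≡_ _≡_ φ ×
      (∀ a b → ResAdj G 𝓕 (φ a) (φ b) ⇔ QAdj a b)

  -- the set of induced Q_i's of R(G;𝓕), counted by α_i(R(G;𝓕))
  InducedCubes : Subset nF → ℕ → Set
  InducedCubes 𝓕 i = Refinement (SubsetFamily nE) (InducedCube 𝓕 i)

module Submission where

-- For every k we build an explicit
-- bijection between the Clar covers with k faces and the induced k-cubes of
-- the resonance graph; both sets are finite, so they have a common size.
--
-- Independence.  Σ is connected and 𝓕 misses a face, so no nonempty family
-- of faces of 𝓕 covers each of its boundary edges at least twice (crossing
-- an edge never leaves the family).  Consequences: distinct faces of 𝓕 have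
-- distinct boundaries, and E(p) ⊕ E(q) ⊕ E(r) ⊕ E(s) = ∅ is impossible for
-- four distinct faces of 𝓕.  The boundary of an even face is an even cycle; its perfect
-- matchings are the two alternating ones, and xor with E(f) swaps them.  A Clar cover S with faces g₀,…,g₍ₖ₋₁₎ and matching
-- M contains exactly 2^k perfect matchings, φ(a) for a ∈ {0,1}^k (choose an
-- alternating matching on each gᵢ); by independence they induce a Q_k.  In a 4-cycle of R(G;𝓕) opposite edges carry the
-- same face and adjacent edges disjoint faces (square lemma), so an induced
-- Q_k labels its k directions by k pairwise disjoint faces and its union is
-- a Clar cover.  The two constructions S ↦ {perfect matchings ⊆ S} and
-- U ↦ ⋃U are mutually inverse.

open import Defs
open import Data.Nat using (ℕ)
open import Data.Fin using (Fin)
open import Data.Fin.Subset using (Subset; _∈_; ⊤)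
open import Data.Product using (∃-syntax; _×_)
open import Relation.Binary.PropositionalEquality using (_≢_)
open import Function.Bundles using (_↔_)

open import Data.Nat as ℕ using (zero; suc; _≤_; _<_; z≤n; s≤s)
open import Data.Nat.Divisibility using (_∣_; divides)
import Data.Nat.Properties as ℕP
open import Data.Fin using (toℕ; fromℕ; fromℕ<; inject₁) renaming (zero to fz; suc to fs)
import Data.Fin.Properties as FP
import Data.Fin.Subset as Sub
import Data.Fin.Subset.Properties as SubP
open import Data.Bool as B using (Bool; true; false; not; _xor_; _∧_; _∨_)
import Data.Bool.Properties as BP
open import Data.Vec as V using (Vec; []; _∷_; lookup; tabulate)
import Data.Vec.Properties as VP
open import Data.Product as P using (Σ; ∃; _,_; proj₁; proj₂)
open import Data.Sum as S using (_⊎_; inj₁; inj₂)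
open import Data.Empty using (⊥; ⊥-elim)
open import Relation.Nullary using (¬_; Dec; yes; no; does)
open import Relation.Nullary.Decidable as Dec using (recompute; dec-true; dec-false)
open import Relation.Binary.PropositionalEquality
  using (_≡_; refl; sym; trans; cong; cong₂; subst; module ≡-Reasoning)
open import Relation.Binary.Construct.Closure.ReflexiveTransitive using (Star; ε; _◅_)
open import Function.Bundles using (_⇔_; mk⇔; Equivalence; mk↔ₛ′)
open import Function.Base using (_∘′_)
import Function.Properties.Inverse as FIP
import Data.Sum.Function.Propositional as SFP
open import Data.Refinement using (Refinement; _,_; value-injective)
open import Data.Irrelevant using ([_])

fwd : ∀ {a b} {A : Set a} {B : Set b} → A ⇔ B → A → B
fwd = Equivalence.to

bwd : ∀ {a b} {A : Set a} {B : Set b} → A ⇔ B → B → A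
bwd = Equivalence.from

dec-witness : ∀ {A : Set} (a? : Dec A) → does a? ≡ true → A
dec-witness (yes a) _ = a
dec-witness (no _) ()

true≢false : true ≢ false
true≢false ()

module _ {n : ℕ} {x : Fin n} {p : Subset n} where

  ∈⇒bit : x ∈ p → lookup p x ≡ true
  ∈⇒bit = VP.[]=⇒lookup

  bit⇒∈ : lookup p x ≡ true → x ∈ p
  bit⇒∈ = VP.lookup⇒[]= x p

  ∉⇒bit : ¬ (x ∈ p) → lookup p x ≡ false
  ∉⇒bit x∉p with lookup p x in eq
  ... | true = ⊥-elim (x∉p (bit⇒∈ eq))
  ... | false = refl

  bit⇒∉ : lookup p x ≡ false → ¬ (x ∈ p)
  bit⇒∉ eq x∈p = true≢false (trans (sym (∈⇒bit x∈p)) eq)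

vec-ext : ∀ {A : Set} {n} (a b : Vec A n) → (∀ i → lookup a i ≡ lookup b i) → a ≡ b
vec-ext [] [] _ = refl
vec-ext (x ∷ a) (y ∷ b) h = cong₂ _∷_ (h fz) (vec-ext a b (λ i → h (fs i)))

subset-ext : ∀ {n} (p q : Subset n) → (∀ x → x ∈ p ⇔ x ∈ q) → p ≡ q
subset-ext p q h = vec-ext p q bits
  where
    bits : ∀ x → lookup p x ≡ lookup q x
    bits x with lookup p x in ep | lookup q x in eq
    ... | true | true = refl
    ... | false | false = refl
    ... | true | false = ⊥-elim (bit⇒∉ eq (fwd (h x) (bit⇒∈ ep)))
    ... | false | true = ⊥-elim (bit⇒∉ ep (bwd (h x) (bit⇒∈ eq)))

xor≡true⇒≡not : ∀ a b → a xor b ≡ true → b ≡ not a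
xor≡true⇒≡not false b eq = eq
xor≡true⇒≡not true false _ = refl
xor≡true⇒≡not true true ()

xor≡true-split : ∀ {a b} → a xor b ≡ true → (a ≡ true × b ≡ false) ⊎ (a ≡ false × b ≡ true)
xor≡true-split {true} {false} _ = inj₁ (refl , refl)
xor≡true-split {false} {true} _ = inj₂ (refl , refl)

xor≡false⇒≡ : ∀ a b → a xor b ≡ false → a ≡ b
xor≡false⇒≡ false false _ = refl
xor≡false⇒≡ true true _ = refl
xor≡false⇒≡ false true ()
xor≡false⇒≡ true false ()

xor≢true⇒≡ : ∀ a b → a xor b ≢ true → a ≡ b
xor≢true⇒≡ false false _ = refl
xor≢true⇒≡ true true _ = refl
xor≢true⇒≡ false true n = ⊥-elim (n refl)
xor≢true⇒≡ true false n = ⊥-elim (n refl)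

xor-cancelˡ : ∀ c a b → c xor a ≡ c xor b → a ≡ b
xor-cancelˡ false a b eq = eq
xor-cancelˡ true a b eq = BP.not-injective eq

xor-cancelʳ : ∀ c a b → a xor c ≡ b xor c → a ≡ b
xor-cancelʳ c a b eq = xor-cancelˡ c a b (trans (BP.xor-comm c a) (trans eq (BP.xor-comm b c)))

xor-absorb : ∀ x y → x xor (x xor y) ≡ y
xor-absorb x y = trans (sym (BP.xor-assoc x x y)) (cong (_xor y) (BP.xor-same x))

xor-shift : ∀ c x y → (c xor x) xor (c xor y) ≡ x xor y
xor-shift c x y = begin
  (c xor x) xor (c xor y) ≡⟨ BP.xor-assoc c x (c xor y) ⟩
  c xor (x xor (c xor y)) ≡⟨ cong (c xor_) (sym (BP.xor-assoc x c y)) ⟩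
  c xor ((x xor c) xor y) ≡⟨ cong (λ z → c xor (z xor y)) (BP.xor-comm x c) ⟩
  c xor ((c xor x) xor y) ≡⟨ cong (c xor_) (BP.xor-assoc c x y) ⟩
  c xor (c xor (x xor y)) ≡⟨ xor-absorb c (x xor y) ⟩
  x xor y ∎
  where open ≡-Reasoning

parityOf : ∀ {n} → (Fin n → Bool) → Bool
parityOf {zero} w = false
parityOf {suc n} w = w fz xor parityOf (λ i → w (fs i))

odd⇒some-true : ∀ {n} (w : Fin n → Bool) → parityOf w ≡ true → ∃[ j ] w j ≡ true
odd⇒some-true {suc n} w odd with w fz in w0
... | true = fz , w0
... | false = P.map fs (λ wj → wj) (odd⇒some-true (λ i → w (fs i)) odd)

even⇒another-true : ∀ {n} (w : Fin n → Bool) → parityOf w ≡ false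
                  → ∀ i → w i ≡ true → ∃[ j ] (j ≢ i × w j ≡ true)
even⇒another-true {suc n} w even fz w0 with odd⇒some-true (λ i → w (fs i)) rest-odd
  where rest-odd : parityOf (λ i → w (fs i)) ≡ true
        rest-odd = BP.not-injective (trans (sym (cong (_xor parityOf (λ i → w (fs i))) w0)) even)
... | j , wj = fs j , (λ ()) , wj
even⇒another-true {suc n} w even (fs i) wi with w fz in w0
... | true = fz , (λ ()) , w0
... | false = P.map fs (P.map₁ (λ j≢i → j≢i ∘′ FP.suc-injective))
                (even⇒another-true (λ i → w (fs i)) even i wi)

-- Around a 4-cycle every bit is flipped twice.
four-cycle-parity : ∀ a b c d → (a xor b) xor ((b xor c) xor ((d xor c) xor ((a xor d) xor false))) ≡ false
four-cycle-parity false false false false = refl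
four-cycle-parity false false false true = refl
four-cycle-parity false false true false = refl
four-cycle-parity false false true true = refl
four-cycle-parity false true false false = refl
four-cycle-parity false true false true = refl
four-cycle-parity false true true false = refl
four-cycle-parity false true true true = refl
four-cycle-parity true false false false = refl
four-cycle-parity true false false true = refl
four-cycle-parity true false true false = refl
four-cycle-parity true false true true = refl
four-cycle-parity true true false false = refl
four-cycle-parity true true false true = refl
four-cycle-parity true true true false = refl
four-cycle-parity true true true true = refl

even₄-cancel₁₃ : ∀ a b d → a xor (b xor (a xor (d xor false))) ≡ false → b ≡ d
even₄-cancel₁₃ a b d even = xor≡false⇒≡ b d (begin
  b xor d                             ≡⟨ sym (xor-absorb a (b xor d)) ⟩
  a xor (a xor (b xor d))             ≡⟨ cong (a xor_) (sym (BP.xor-assoc a b d)) ⟩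
  a xor ((a xor b) xor d)             ≡⟨ cong (λ z → a xor (z xor d)) (BP.xor-comm a b) ⟩
  a xor ((b xor a) xor d)             ≡⟨ cong (a xor_) (BP.xor-assoc b a d) ⟩
  a xor (b xor (a xor d))             ≡⟨ cong (λ z → a xor (b xor (a xor z))) (sym (BP.xor-identityʳ d)) ⟩
  a xor (b xor (a xor (d xor false))) ≡⟨ even ⟩
  false ∎)
  where open ≡-Reasoning

even₄-cancel₂₄ : ∀ a b c → a xor (b xor (c xor (b xor false))) ≡ false → a ≡ c
even₄-cancel₂₄ a b c even = even₄-cancel₁₃ b a c (begin
  b xor (a xor (b xor (c xor false))) ≡⟨ sym (BP.xor-assoc b a _) ⟩
  (b xor a) xor (b xor (c xor false)) ≡⟨ cong₂ _xor_ (BP.xor-comm b a) (cong (b xor_) (BP.xor-identityʳ c)) ⟩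
  (a xor b) xor (b xor c)             ≡⟨ cong ((a xor b) xor_) (BP.xor-comm b c) ⟩
  (a xor b) xor (c xor b)             ≡⟨ BP.xor-assoc a b _ ⟩
  a xor (b xor (c xor b))             ≡⟨ cong (λ z → a xor (b xor (c xor z))) (sym (BP.xor-identityʳ b)) ⟩
  a xor (b xor (c xor (b xor false))) ≡⟨ even ⟩
  false ∎)
  where open ≡-Reasoning

flip : ∀ {k} → Fin k → Vec Bool k → Vec Bool k
flip fz (b ∷ a) = not b ∷ a
flip (fs j) (b ∷ a) = b ∷ flip j a

flip-same : ∀ {k} (j : Fin k) a → lookup (flip j a) j ≡ not (lookup a j)
flip-same fz (b ∷ a) = refl
flip-same (fs j) (b ∷ a) = flip-same j a

flip-other : ∀ {k} (i j : Fin k) a → i ≢ j → lookup (flip j a) i ≡ lookup a i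
flip-other fz fz a i≢j = ⊥-elim (i≢j refl)
flip-other fz (fs j) (b ∷ a) _ = refl
flip-other (fs i) fz (b ∷ a) _ = refl
flip-other (fs i) (fs j) (b ∷ a) i≢j = flip-other i j a (λ e → i≢j (cong fs e))

flip-involutive : ∀ {k} (j : Fin k) a → flip j (flip j a) ≡ a
flip-involutive fz (b ∷ a) = cong (_∷ a) (BP.not-involutive b)
flip-involutive (fs j) (b ∷ a) = cong (b ∷_) (flip-involutive j a)

flip-comm : ∀ {k} (i j : Fin k) a → flip i (flip j a) ≡ flip j (flip i a)
flip-comm fz fz (b ∷ a) = refl
flip-comm fz (fs j) (b ∷ a) = refl
flip-comm (fs i) fz (b ∷ a) = refl
flip-comm (fs i) (fs j) (b ∷ a) = cong (b ∷_) (flip-comm i j a)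

flip₂-≢ : ∀ {k} (i j : Fin k) a → i ≢ j → flip i (flip j a) ≢ a
flip₂-≢ i j a i≢j eq = BP.not-¬ refl (sym (begin
  not (lookup a i)            ≡⟨ cong not (sym (flip-other i j a i≢j)) ⟩
  not (lookup (flip j a) i)   ≡⟨ sym (flip-same i (flip j a)) ⟩
  lookup (flip i (flip j a)) i ≡⟨ cong (λ z → lookup z i) eq ⟩
  lookup a i ∎))
  where open ≡-Reasoning

qadj-flip : ∀ {k} (j : Fin k) a → QAdj a (flip j a)
qadj-flip fz (b ∷ a) = inj₁ (BP.not-¬ refl , refl)
qadj-flip (fs j) (b ∷ a) = inj₂ (refl , qadj-flip j a)

qadj⇒flip : ∀ {k} (a b : Vec Bool k) → QAdj a b → ∃[ j ] b ≡ flip j a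
qadj⇒flip [] [] ()
qadj⇒flip (x ∷ a) (y ∷ b) (inj₁ (x≢y , refl)) = fz , cong (_∷ a) (BP.¬-not (λ eq → x≢y (sym eq)))
qadj⇒flip (x ∷ a) (y ∷ b) (inj₂ (refl , q)) = P.map fs (cong (x ∷_)) (qadj⇒flip a b q)

cube-induction : ∀ {k} (P : Vec Bool k → Set) → P (V.replicate k false)
               → (∀ a j → P a → P (flip j a)) → ∀ a → P a
cube-induction {zero} P p0 step [] = p0
cube-induction {suc k} P p0 step (b ∷ a) =
  pick b (cube-induction P′ (p0 , step _ fz p0) step′ a)
  where
    P′ : Vec Bool k → Set
    P′ a = P (false ∷ a) × P (true ∷ a)
    step′ : ∀ a j → P′ a → P′ (flip j a)
    step′ a j (x , y) = step _ (fs j) x , step _ (fs j) y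
    pick : ∀ b {a} → P′ a → P (b ∷ a)
    pick false = proj₁
    pick true = proj₂

family : ∀ {n} → (Subset n → Bool) → SubsetFamily n
family {zero} P = P []
family {suc n} P = family (λ s → P (false ∷ s)) , family (λ s → P (true ∷ s))

∈-family : ∀ {n} (P : Subset n → Bool) (N : Subset n) → N ∈ᶠ family P ⇔ (P N ≡ true)
∈-family {zero} P [] = mk⇔ (λ x → x) (λ x → x)
∈-family {suc n} P (false ∷ N) = ∈-family (λ s → P (false ∷ s)) N
∈-family {suc n} P (true ∷ N) = ∈-family (λ s → P (true ∷ s)) N

family-ext : ∀ {n} (U W : SubsetFamily n) → (∀ N → N ∈ᶠ U → N ∈ᶠ W) → (∀ N → N ∈ᶠ W → N ∈ᶠ U) → U ≡ W
family-ext {zero} false false _ _ = refl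
family-ext {zero} true true _ _ = refl
family-ext {zero} false true _ W⊆U with W⊆U [] refl
... | ()
family-ext {zero} true false U⊆W _ with U⊆W [] refl
... | ()
family-ext {suc n} (U₀ , U₁) (W₀ , W₁) U⊆W W⊆U =
  cong₂ _,_ (family-ext U₀ W₀ (λ N → U⊆W (false ∷ N)) (λ N → W⊆U (false ∷ N)))
            (family-ext U₁ W₁ (λ N → U⊆W (true ∷ N)) (λ N → W⊆U (true ∷ N)))

family-≟ : ∀ {n} (U W : SubsetFamily n) → Dec (U ≡ W)
family-≟ {zero} U W = U B.≟ W
family-≟ {suc n} (U₀ , U₁) (W₀ , W₁) with family-≟ U₀ W₀ | family-≟ U₁ W₁
... | yes refl | yes refl = yes refl
... | no U₀≢W₀ | _ = no (λ { refl → U₀≢W₀ refl })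
... | _ | no U₁≢W₁ = no (λ { refl → U₁≢W₁ refl })

nonempty : ∀ {n} → SubsetFamily n → Bool
nonempty {zero} b = b
nonempty {suc n} (U₀ , U₁) = nonempty U₀ ∨ nonempty U₁

nonempty-sound : ∀ {n} (U : SubsetFamily n) → nonempty U ≡ true → ∃[ N ] N ∈ᶠ U
nonempty-sound {zero} U eq = [] , eq
nonempty-sound {suc n} (U₀ , U₁) eq with nonempty U₀ in e₀
... | true = P.map (false ∷_) (λ m → m) (nonempty-sound U₀ e₀)
... | false = P.map (true ∷_) (λ m → m) (nonempty-sound U₁ eq)

nonempty-complete : ∀ {n} (U : SubsetFamily n) N → N ∈ᶠ U → nonempty U ≡ true
nonempty-complete {zero} U [] m = m
nonempty-complete {suc n} (U₀ , U₁) (false ∷ N) m rewrite nonempty-complete U₀ N m = refl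
nonempty-complete {suc n} (U₀ , U₁) (true ∷ N) m rewrite nonempty-complete U₁ N m = BP.∨-zeroʳ (nonempty U₀)

⋃ : ∀ {n} → SubsetFamily n → Subset n
⋃ {zero} U = []
⋃ {suc n} (U₀ , U₁) = nonempty U₁ ∷ V.zipWith _∨_ (⋃ U₀) (⋃ U₁)

∈⋃⇒ : ∀ {n} (U : SubsetFamily n) e → e ∈ ⋃ U → ∃[ N ] (N ∈ᶠ U × e ∈ N)
∈⋃⇒ U e e∈ = P.map₂ (P.map₂ bit⇒∈) (bits U e (∈⇒bit e∈))
  where
    bits : ∀ {n} (U : SubsetFamily n) e → lookup (⋃ U) e ≡ true → ∃[ N ] (N ∈ᶠ U × lookup N e ≡ true)
    bits {suc n} (U₀ , U₁) fz eq with nonempty-sound U₁ eq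
    ... | N , m = true ∷ N , m , refl
    bits {suc n} (U₀ , U₁) (fs e) eq rewrite VP.lookup-zipWith _∨_ e (⋃ U₀) (⋃ U₁) with lookup (⋃ U₀) e in e₀
    ... | true = P.map (false ∷_) (λ m → m) (bits U₀ e e₀)
    ... | false = P.map (true ∷_) (λ m → m) (bits U₁ e eq)

⇒∈⋃ : ∀ {n} (U : SubsetFamily n) e N → N ∈ᶠ U → e ∈ N → e ∈ ⋃ U
⇒∈⋃ U e N m e∈N = bit⇒∈ (bits U e N m (∈⇒bit e∈N))
  where
    bits : ∀ {n} (U : SubsetFamily n) e N → N ∈ᶠ U → lookup N e ≡ true → lookup (⋃ U) e ≡ true
    bits {suc n} (U₀ , U₁) fz (true ∷ N) m refl = nonempty-complete U₁ N m
    bits {suc n} (U₀ , U₁) (fs e) (false ∷ N) m eq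
      rewrite VP.lookup-zipWith _∨_ e (⋃ U₀) (⋃ U₁) | bits U₀ e N m eq = refl
    bits {suc n} (U₀ , U₁) (fs e) (true ∷ N) m eq
      rewrite VP.lookup-zipWith _∨_ e (⋃ U₀) (⋃ U₁) | bits U₁ e N m eq = BP.∨-zeroʳ _

Enumeration : ∀ {n} (p : Subset n) → Set
Enumeration {n} p = Σ (Fin (Sub.∣ p ∣) → Fin n) λ e →
  (∀ {i j} → e i ≡ e j → i ≡ j) × (∀ i → e i ∈ p) × (∀ x → x ∈ p → ∃[ i ] e i ≡ x)

enumerate : ∀ {n} (p : Subset n) → Enumeration p
enumerate {zero} [] = (λ ()) , (λ {i} → ⊥-elim (FP.¬Fin0 i)) , (λ ()) , (λ ())
enumerate {suc n} (false ∷ p) with enumerate p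
... | e , e-inj , e∈ , e-onto = (λ i → fs (e i)) , (λ eq → e-inj (FP.suc-injective eq)) , (λ i → V.there (e∈ i)) , onto
  where onto : ∀ x → x ∈ (false ∷ p) → ∃[ i ] fs (e i) ≡ x
        onto (fs x) (V.there m) = P.map₂ (cong fs) (e-onto x m)
enumerate {suc n} (true ∷ p) with enumerate p
... | e , e-inj , e∈ , e-onto = e′ , inj , mem , onto
  where
    e′ : Fin (suc Sub.∣ p ∣) → Fin (suc n)
    e′ fz = fz
    e′ (fs i) = fs (e i)
    inj : ∀ {i j} → e′ i ≡ e′ j → i ≡ j
    inj {fz} {fz} eq = refl
    inj {fs i} {fs j} eq = cong fs (e-inj (FP.suc-injective eq))
    mem : ∀ i → e′ i ∈ (true ∷ p)
    mem fz = V.here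
    mem (fs i) = V.there (e∈ i)
    onto : ∀ x → x ∈ (true ∷ p) → ∃[ i ] e′ i ≡ x
    onto fz _ = fz , refl
    onto (fs x) (V.there m) = P.map fs (cong fs) (e-onto x m)

∣p∣≡size-of-enumeration : ∀ {n k} (p : Subset n) (g : Fin k → Fin n) → (∀ {i j} → g i ≡ g j → i ≡ j)
                        → (∀ i → g i ∈ p) → (∀ x → x ∈ p → ∃[ i ] g i ≡ x) → Sub.∣ p ∣ ≡ k
∣p∣≡size-of-enumeration p g g-inj g∈ g-onto with enumerate p
... | e , e-inj , e∈ , e-onto = FP.cantor-schröder-bernstein {f = e→g} {g = g→e} e→g-inj g→e-inj
  where
    e→g : Fin Sub.∣ p ∣ → Fin _
    e→g j = proj₁ (g-onto (e j) (e∈ j))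
    e→g-inj : ∀ {x y} → e→g x ≡ e→g y → x ≡ y
    e→g-inj {x} {y} eq = e-inj (trans (sym (proj₂ (g-onto (e x) (e∈ x)))) (trans (cong g eq) (proj₂ (g-onto (e y) (e∈ y)))))
    g→e : Fin _ → Fin Sub.∣ p ∣
    g→e i = proj₁ (e-onto (g i) (g∈ i))
    g→e-inj : ∀ {x y} → g→e x ≡ g→e y → x ≡ y
    g→e-inj {x} {y} eq = g-inj (trans (sym (proj₂ (e-onto (g x) (g∈ x)))) (trans (cong e eq) (proj₂ (e-onto (g y) (g∈ y)))))

decidable-subsets-finite : ∀ {n} (P : Subset n → Set) → (∀ S → Dec (P S))
                         → ∃[ a ] (Fin a ↔ Refinement (Subset n) P)
decidable-subsets-finite {zero} P P? with P? []
... | yes p = 1 , mk↔ₛ′ (λ _ → [] , [ p ]) (λ _ → fz) (λ { ([] , _) → refl }) (λ { fz → refl ; (fs ()) })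
... | no ¬p = 0 , mk↔ₛ′ (λ ()) (λ { ([] , [ p ]) → ⊥-elim (¬p (recompute (P? []) p)) })
                        (λ { ([] , [ p ]) → ⊥-elim (¬p (recompute (P? []) p)) }) (λ ())
decidable-subsets-finite {suc n} P P?
  with decidable-subsets-finite (λ s → P (false ∷ s)) (λ s → P? (false ∷ s))
     | decidable-subsets-finite (λ s → P (true ∷ s)) (λ s → P? (true ∷ s))
... | a₀ , i₀ | a₁ , i₁ = a₀ ℕ.+ a₁ , FIP.↔-trans FP.+↔⊎ (FIP.↔-trans (i₀ SFP.⊎-↔ i₁) (FIP.↔-sym split))
  where
    R R₀ R₁ : Set
    R = Refinement (Subset (suc n)) P
    R₀ = Refinement (Subset n) (λ s → P (false ∷ s))
    R₁ = Refinement (Subset n) (λ s → P (true ∷ s))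
    to : R → R₀ ⊎ R₁
    to ((false ∷ s) , [ p ]) = inj₁ (s , [ p ])
    to ((true ∷ s) , [ p ]) = inj₂ (s , [ p ])
    from : R₀ ⊎ R₁ → R
    from (inj₁ (s , [ p ])) = (false ∷ s) , [ p ]
    from (inj₂ (s , [ p ])) = (true ∷ s) , [ p ]
    split : R ↔ (R₀ ⊎ R₁)
    split = mk↔ₛ′ to from (λ { (inj₁ _) → refl ; (inj₂ _) → refl })
                          (λ { ((false ∷ s) , _) → refl ; ((true ∷ s) , _) → refl })

module CyclicOrder (L : ℕ) (2≤L : 2 ≤ L) where

  I : Set
  I = Fin (suc L)

  Succ : I → I → Set
  Succ i j = (suc (toℕ i) ≡ toℕ j) ⊎ (toℕ i ≡ L × toℕ j ≡ 0)

  private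
    bound : (i : I) → toℕ i ≤ L
    bound = FP.toℕ≤pred[n]

    L≢0 : L ≢ 0
    L≢0 L≡0 = ℕP.<⇒≱ (s≤s z≤n) (subst (2 ≤_) L≡0 2≤L)

    L≢1 : L ≢ 1
    L≢1 L≡1 = ℕP.<⇒≱ (s≤s (s≤s z≤n)) (subst (2 ≤_) L≡1 2≤L)

  private
    last-has-no-successor : ∀ {i j : I} → toℕ i ≡ L → suc (toℕ i) ≡ toℕ j → ⊥
    last-has-no-successor {j = j} i≡L p = ℕP.1+n≰n (subst (λ z → suc z ≤ L) i≡L (subst (_≤ L) (sym p) (bound j)))

  succ-functional : ∀ {i j j′} → Succ i j → Succ i j′ → j ≡ j′
  succ-functional (inj₁ p) (inj₁ q) = FP.toℕ-injective (trans (sym p) q)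
  succ-functional {j = j} (inj₁ p) (inj₂ (i≡L , _)) = ⊥-elim (last-has-no-successor i≡L p)
  succ-functional {j′ = j′} (inj₂ (i≡L , _)) (inj₁ q) = ⊥-elim (last-has-no-successor i≡L q)
  succ-functional (inj₂ (_ , j≡0)) (inj₂ (_ , j′≡0)) = FP.toℕ-injective (trans j≡0 (sym j′≡0))

  succ-injective : ∀ {i i′ j} → Succ i j → Succ i′ j → i ≡ i′
  succ-injective (inj₁ p) (inj₁ q) = FP.toℕ-injective (ℕP.suc-injective (trans p (sym q)))
  succ-injective (inj₁ p) (inj₂ (_ , j≡0)) = ⊥-elim (ℕP.1+n≢0 (trans p j≡0))
  succ-injective (inj₂ (_ , j≡0)) (inj₁ q) = ⊥-elim (ℕP.1+n≢0 (trans q j≡0))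
  succ-injective (inj₂ (i≡L , _)) (inj₂ (i′≡L , _)) = FP.toℕ-injective (trans i≡L (sym i′≡L))

  succ-irreflexive : ∀ {i} → Succ i i → ⊥
  succ-irreflexive (inj₁ p) = ℕP.1+n≢n p
  succ-irreflexive (inj₂ (i≡L , i≡0)) = L≢0 (trans (sym i≡L) i≡0)

  -- Since the cycle has at least three elements, i → j → i is impossible.
  succ-asymmetric : ∀ {i j} → Succ i j → Succ j i → ⊥
  succ-asymmetric {i} (inj₁ p) (inj₁ q) = ℕP.m+1+n≢n 1 (trans (cong suc p) q)
  succ-asymmetric (inj₁ p) (inj₂ (j≡L , i≡0)) = L≢1 (trans (sym j≡L) (trans (sym p) (cong suc i≡0)))
  succ-asymmetric (inj₂ (i≡L , j≡0)) (inj₁ q) = L≢1 (trans (sym i≡L) (trans (sym q) (cong suc j≡0)))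
  succ-asymmetric (inj₂ (i≡L , j≡0)) (inj₂ (_ , i≡0)) = L≢0 (trans (sym i≡L) i≡0)

  next : I → I
  next i with toℕ i ℕ.<? L
  ... | yes i<L = fromℕ< (s≤s i<L)
  ... | no _ = fz

  succ-next : ∀ i → Succ i (next i)
  succ-next i with toℕ i ℕ.<? L
  ... | yes i<L = inj₁ (sym (FP.toℕ-fromℕ< (s≤s i<L)))
  ... | no i≮L = inj₂ (ℕP.≤-antisym (bound i) (ℕP.≮⇒≥ i≮L) , refl)

  prev : I → I
  prev fz = fromℕ L
  prev (fs i) = inject₁ i

  succ-prev : ∀ i → Succ (prev i) i
  succ-prev fz = inj₂ (FP.toℕ-fromℕ L , refl)
  succ-prev (fs i) = inj₁ (cong suc (FP.toℕ-inject₁ i))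

  next-prev : ∀ i → next (prev i) ≡ i
  next-prev i = succ-functional (succ-next (prev i)) (succ-prev i)

  prev-next : ∀ i → prev (next i) ≡ i
  prev-next i = succ-injective (succ-prev (next i)) (succ-next i)

  next-below-last : ∀ i → toℕ i < L → toℕ (next i) ≡ suc (toℕ i)
  next-below-last i i<L with succ-next i
  ... | inj₁ p = sym p
  ... | inj₂ (i≡L , _) = ⊥-elim (ℕP.<-irrefl i≡L i<L)

  -- Cyclic induction: a property preserved by next holds everywhere once it
  -- holds somewhere.  We climb from i₀ to the last index, wrap to 0, and
  -- climb from 0 to any j.
  module _ (W : I → Set) (step : ∀ i → W i → W (next i)) where

    private
      climb-to-last : ∀ m (i : I) → toℕ i ℕ.+ m ≡ L → W i → W (fromℕ L)
      climb-to-last zero i eq w = subst W (FP.toℕ-injective (trans (trans (sym (ℕP.+-identityʳ _)) eq) (sym (FP.toℕ-fromℕ L)))) w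
      climb-to-last (suc m) i eq w = climb-to-last m (next i) eq′ (step i w)
        where
          i<L : toℕ i < L
          i<L = subst (toℕ i <_) eq (ℕP.m<m+n (toℕ i) (s≤s z≤n))
          eq′ : toℕ (next i) ℕ.+ m ≡ L
          eq′ = trans (cong (ℕ._+ m) (next-below-last i i<L)) (trans (sym (ℕP.+-suc (toℕ i) m)) eq)

      climb-from-zero : W fz → ∀ m (m<1+L : m < suc L) → W (fromℕ< m<1+L)
      climb-from-zero w zero _ = w
      climb-from-zero w (suc m) m+1<1+L = subst W next≡ (step _ (climb-from-zero w m m<1+L))
        where
          m<1+L : m < suc L
          m<1+L = ℕP.<-trans (ℕP.n<1+n m) m+1<1+L
          next≡ : next (fromℕ< m<1+L) ≡ fromℕ< m+1<1+L
          next≡ = FP.toℕ-injective (begin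
            toℕ (next (fromℕ< m<1+L)) ≡⟨ next-below-last _ (subst (_< L) (sym (FP.toℕ-fromℕ< _)) (ℕP.≤-pred m+1<1+L)) ⟩
            suc (toℕ (fromℕ< m<1+L))  ≡⟨ cong suc (FP.toℕ-fromℕ< _) ⟩
            suc m                     ≡⟨ sym (FP.toℕ-fromℕ< m+1<1+L) ⟩
            toℕ (fromℕ< m+1<1+L) ∎)
            where open ≡-Reasoning

    cyclic-induction : ∀ i₀ → W i₀ → ∀ j → W j
    cyclic-induction i₀ w j = subst W (FP.fromℕ<-toℕ j (FP.toℕ<n j)) (climb-from-zero w₀ (toℕ j) (FP.toℕ<n j))
      where
        w-last : W (fromℕ L)
        w-last = climb-to-last (L ℕ.∸ toℕ i₀) i₀ (ℕP.m+[n∸m]≡n (bound i₀)) w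
        w₀ : W fz
        w₀ = subst W (succ-functional (succ-next (fromℕ L)) (inj₂ (FP.toℕ-fromℕ L , refl))) (step _ w-last)

  isEven : ℕ → Bool
  isEven zero = true
  isEven (suc m) = not (isEven m)

  private
    isEven-double : ∀ q → isEven (q ℕ.* 2) ≡ true
    isEven-double zero = refl
    isEven-double (suc q) rewrite isEven-double q = refl

    last-odd : 2 ∣ suc L → isEven L ≡ false
    last-odd (divides q eq) = BP.not-injective (trans (cong isEven eq) (isEven-double q))

  isEven-next : 2 ∣ suc L → ∀ i → isEven (toℕ (next i)) ≡ not (isEven (toℕ i))
  isEven-next 2∣1+L i with succ-next i
  ... | inj₁ p = cong isEven (sym p)
  ... | inj₂ (i≡L , next≡0) = begin
    isEven (toℕ (next i)) ≡⟨ cong isEven next≡0 ⟩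
    true                  ≡⟨ sym (cong not (last-odd 2∣1+L)) ⟩
    not (isEven L)        ≡⟨ cong (λ z → not (isEven z)) (sym i≡L) ⟩
    not (isEven (toℕ i)) ∎
    where open ≡-Reasoning

-- Local structure of an embedded graph: edges, their ends and their sides.
module Embedded (G : EmbeddedGraph) where
  open EmbeddedGraph G

  private
    FlagsOfEdge : Fin nX → Fin nX → Set
    FlagsOfEdge x y = y ≡ x ⊎ y ≡ τ₀ x ⊎ y ≡ τ₂ x ⊎ y ≡ τ₀ (τ₂ x)

    flags-step : ∀ x y z → FlagsOfEdge x y → Steps τ₀ τ₂ y z → FlagsOfEdge x z
    flags-step x .x z (inj₁ refl) (inj₁ refl) = inj₂ (inj₁ refl)
    flags-step x .x z (inj₁ refl) (inj₂ refl) = inj₂ (inj₂ (inj₁ refl))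
    flags-step x _ z (inj₂ (inj₁ refl)) (inj₁ refl) = inj₁ (τ₀-inv x)
    flags-step x _ z (inj₂ (inj₁ refl)) (inj₂ refl) = inj₂ (inj₂ (inj₂ (sym (τ₀τ₂-comm x))))
    flags-step x _ z (inj₂ (inj₂ (inj₁ refl))) (inj₁ refl) = inj₂ (inj₂ (inj₂ refl))
    flags-step x _ z (inj₂ (inj₂ (inj₁ refl))) (inj₂ refl) = inj₁ (τ₂-inv x)
    flags-step x _ z (inj₂ (inj₂ (inj₂ refl))) (inj₁ refl) = inj₂ (inj₂ (inj₁ (τ₀-inv (τ₂ x))))
    flags-step x _ z (inj₂ (inj₂ (inj₂ refl))) (inj₂ refl) =
      inj₂ (inj₁ (trans (cong τ₂ (τ₀τ₂-comm x)) (τ₂-inv (τ₀ x))))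

    flags-orbit : ∀ x y z → FlagsOfEdge x y → Orbit τ₀ τ₂ y z → FlagsOfEdge x z
    flags-orbit x y .y q ε = q
    flags-orbit x y z q (s ◅ r) = flags-orbit x _ z (flags-step x y _ q s) r

    same-edge : ∀ x y → edg x ≡ edg y → FlagsOfEdge x y
    same-edge x y eq = flags-orbit x x y (inj₁ refl) (fwd (edg-orbit x y) eq)

    vtx-τ₂ : ∀ x → vtx (τ₂ x) ≡ vtx x
    vtx-τ₂ x = sym (bwd (vtx-orbit x (τ₂ x)) (inj₂ refl ◅ ε))

  endpoints : ∀ x v → Inc G (edg x) v → v ≡ vtx x ⊎ v ≡ vtx (τ₀ x)
  endpoints x v (y , ey , refl) with same-edge x y (sym ey)
  ... | inj₁ refl = inj₁ refl
  ... | inj₂ (inj₁ refl) = inj₂ refl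
  ... | inj₂ (inj₂ (inj₁ refl)) = inj₁ (vtx-τ₂ x)
  ... | inj₂ (inj₂ (inj₂ refl)) = inj₂ (trans (cong vtx (τ₀τ₂-comm x)) (vtx-τ₂ (τ₀ x)))

  sides : ∀ x f → OnFace G f (edg x) → f ≡ fac x ⊎ f ≡ fac (τ₂ x)
  sides x f (y , ey , refl) with same-edge x y (sym ey)
  ... | inj₁ refl = inj₁ refl
  ... | inj₂ (inj₁ refl) = inj₁ (fac-τ₀ x)
  ... | inj₂ (inj₂ (inj₁ refl)) = inj₂ refl
  ... | inj₂ (inj₂ (inj₂ refl)) = inj₂ (fac-τ₀ (τ₂ x))

  two-ends : ∀ e u w v → Joins G e u w → Inc G e v → v ≡ u ⊎ v ≡ w
  two-ends e u w v (iu , iw , u≢w) (x , refl , xv) with endpoints x u iu | endpoints x w iw | endpoints x v (x , refl , xv)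
  ... | inj₁ a | inj₁ b | _ = ⊥-elim (u≢w (trans a (sym b)))
  ... | inj₂ a | inj₂ b | _ = ⊥-elim (u≢w (trans a (sym b)))
  ... | inj₁ a | inj₂ b | inj₁ c = inj₁ (trans c (sym a))
  ... | inj₁ a | inj₂ b | inj₂ c = inj₂ (trans c (sym b))
  ... | inj₂ a | inj₁ b | inj₁ c = inj₂ (trans c (sym b))
  ... | inj₂ a | inj₁ b | inj₂ c = inj₁ (trans c (sym a))

  no-parallel-edges : ∀ e e′ u w → Joins G e u w → Joins G e′ u w → e ≡ e′
  no-parallel-edges e e′ u w j j′ with flag-at e u w j | flag-at e′ u w j′
    where
      flag-at : ∀ e u w → Joins G e u w → ∃[ x ] (edg x ≡ e × vtx x ≡ u × vtx (τ₀ x) ≡ w)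
      flag-at e u w ((x , refl , xu) , iw , u≢w) with endpoints x w iw
      ... | inj₁ a = ⊥-elim (u≢w (trans (sym xu) (sym a)))
      ... | inj₂ a = x , refl , xu , sym a
  ... | x , refl , xu , xw | y , refl , yu , yw = no-parallel x y (trans xu (sym yu)) (trans xw (sym yw))

  some-end : ∀ e → ∃[ v ] Inc G e v
  some-end e with edg-surj e
  ... | x , refl = vtx x , x , refl , refl

  Inc? : ∀ e v → Dec (Inc G e v)
  Inc? e v = FP.any? (λ x → (edg x FP.≟ e) Dec.×-dec (vtx x FP.≟ v))

  OnFace? : ∀ f e → Dec (OnFace G f e)
  OnFace? f e = FP.any? (λ x → (edg x FP.≟ e) Dec.×-dec (fac x FP.≟ f))

  VOnFace? : ∀ f v → Dec (VOnFace G f v)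
  VOnFace? f v = FP.any? (λ x → (vtx x FP.≟ v) Dec.×-dec (fac x FP.≟ f))
                 Dec.⊎-dec (Dec.¬? (FP.any? (λ x → vtx x FP.≟ v)) Dec.×-dec (isoFace v FP.≟ f))

  UniquelyMatched : Subset nE → Fin nV → Set
  UniquelyMatched M v = ∃[ e ] (e ∈ M × Inc G e v × (∀ e′ → e′ ∈ M → Inc G e′ v → e′ ≡ e))

  onFace : Fin nF → Fin nE → Bool
  onFace f e = does (OnFace? f e)

  Disjoint : Fin nF → Fin nF → Set
  Disjoint p q = ∀ v → VOnFace G p v → VOnFace G q v → ⊥

  module Independence (𝓕 : Subset nF) (𝓕≢⊤ : 𝓕 ≢ ⊤) where

    -- A family of faces of 𝓕 closed under crossing edges is empty: by
    -- connectedness of Σ it would reach every face.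
    crossing-closed-empty : (A : Fin nF → Set) → (∀ g → A g → g ∈ 𝓕)
                          → (∀ x → A (fac x) → A (fac (τ₂ x))) → ∀ g → ¬ A g
    crossing-closed-empty A A⊆𝓕 cross g a = 𝓕≢⊤ (SubP.⊆-antisym (λ _ → SubP.∈⊤)
        (λ {h} _ → A⊆𝓕 h (reach (faceN g) (faceN h) (connected _ _) a)))
      where
        AN : Node nX nV nF → Set
        AN (flagN x) = A (fac x)
        AN (vertN v) = (∀ x → vtx x ≡ v → A (fac x)) × (Isolated G v → A (isoFace v))
        AN (faceN g) = A g

        around-vertex : ∀ x y → Orbit τ₁ τ₂ x y → A (fac x) → A (fac y)
        around-vertex x .x ε a = a
        around-vertex x y (inj₁ refl ◅ r) a = around-vertex _ y r (subst A (sym (fac-τ₁ x)) a)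
        around-vertex x y (inj₂ refl ◅ r) a = around-vertex _ y r (cross x a)

        uncross : ∀ x → A (fac (τ₂ x)) → A (fac x)
        uncross x a = subst (λ z → A (fac z)) (τ₂-inv x) (cross (τ₂ x) a)

        forward : ∀ {a b} → Link₀ τ₀ τ₁ τ₂ vtx fac isoFace a b → AN a → AN b
        forward (l-τ₀ x) p = subst A (sym (fac-τ₀ x)) p
        forward (l-τ₁ x) p = subst A (sym (fac-τ₁ x)) p
        forward (l-τ₂ x) p = cross x p
        forward (l-vtx x) p = (λ y yv → around-vertex x y (fwd (vtx-orbit x y) (sym yv)) p) , (λ iso → ⊥-elim (iso (x , refl)))
        forward (l-fac x) p = p
        forward (l-iso v iso) p = proj₂ p iso

        backward : ∀ {a b} → Link₀ τ₀ τ₁ τ₂ vtx fac isoFace a b → AN b → AN a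
        backward (l-τ₀ x) p = subst A (fac-τ₀ x) p
        backward (l-τ₁ x) p = subst A (fac-τ₁ x) p
        backward (l-τ₂ x) p = uncross x p
        backward (l-vtx x) p = proj₁ p x refl
        backward (l-fac x) p = p
        backward (l-iso v iso) p = (λ x xv → ⊥-elim (iso (x , xv))) , (λ _ → p)

        reach : ∀ a b → Star (Link τ₀ τ₁ τ₂ vtx fac isoFace) a b → AN a → AN b
        reach a .a ε p = p
        reach a b (inj₁ l ◅ r) p = reach _ b r (forward l p)
        reach a b (inj₂ l ◅ r) p = reach _ b r (backward l p)

    doubly-covered-empty : (A : Fin nF → Set) → (∀ g → A g → g ∈ 𝓕)
                         → (∀ a e → A a → OnFace G a e → ∃[ b ] (A b × b ≢ a × OnFace G b e))
                         → ∀ g → ¬ A g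
    doubly-covered-empty A A⊆𝓕 covered = crossing-closed-empty A A⊆𝓕 cross
      where
        cross : ∀ x → A (fac x) → A (fac (τ₂ x))
        cross x a with covered (fac x) (edg x) a (x , refl , refl)
        ... | b , Ab , b≢a , b-on with sides x b b-on
        ...   | inj₁ b≡a = ⊥-elim (b≢a b≡a)
        ...   | inj₂ refl = Ab

    independent : ∀ {n} (F : Fin n → Fin nF) → (∀ {i j} → F i ≡ F j → i ≡ j) → (∀ i → F i ∈ 𝓕)
                → (∀ e → parityOf (λ i → onFace (F i) e) ≡ false) → ¬ Fin n
    independent F F-inj F∈𝓕 even i = doubly-covered-empty InImage A⊆𝓕 covered (F i) (i , refl)
      where
        InImage : Fin nF → Set
        InImage g = ∃[ i ] F i ≡ g
        A⊆𝓕 : ∀ g → InImage g → g ∈ 𝓕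
        A⊆𝓕 g (i , refl) = F∈𝓕 i
        covered : ∀ a e → InImage a → OnFace G a e → ∃[ b ] (InImage b × b ≢ a × OnFace G b e)
        covered a e (i , refl) on with even⇒another-true (λ i → onFace (F i) e) (even e) i (dec-true (OnFace? (F i) e) on)
        ... | j , j≢i , on-j = F j , (j , refl) , (λ eq → j≢i (F-inj eq)) , dec-witness (OnFace? (F j) e) on-j

    no-four-cancelling : ∀ p q r s → p ∈ 𝓕 → q ∈ 𝓕 → r ∈ 𝓕 → s ∈ 𝓕
                       → p ≢ q → p ≢ r → p ≢ s → q ≢ r → q ≢ s → r ≢ s
                       → (∀ e → onFace p e xor (onFace q e xor (onFace r e xor (onFace s e xor false))) ≡ false) → ⊥
    no-four-cancelling p q r s p∈𝓕 q∈𝓕 r∈𝓕 s∈𝓕 p≢q p≢r p≢s q≢r q≢s r≢s cancel =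
      independent faces faces-injective faces∈𝓕 cancel fz
      where
        faces : Fin 4 → Fin nF
        faces fz = p
        faces (fs fz) = q
        faces (fs (fs fz)) = r
        faces (fs (fs (fs fz))) = s
        faces∈𝓕 : ∀ i → faces i ∈ 𝓕
        faces∈𝓕 fz = p∈𝓕
        faces∈𝓕 (fs fz) = q∈𝓕
        faces∈𝓕 (fs (fs fz)) = r∈𝓕
        faces∈𝓕 (fs (fs (fs fz))) = s∈𝓕
        faces-injective : ∀ {i j} → faces i ≡ faces j → i ≡ j
        faces-injective {fz} {fz} _ = refl
        faces-injective {fz} {fs fz} eq = ⊥-elim (p≢q eq)
        faces-injective {fz} {fs (fs fz)} eq = ⊥-elim (p≢r eq)
        faces-injective {fz} {fs (fs (fs fz))} eq = ⊥-elim (p≢s eq)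
        faces-injective {fs fz} {fz} eq = ⊥-elim (p≢q (sym eq))
        faces-injective {fs fz} {fs fz} _ = refl
        faces-injective {fs fz} {fs (fs fz)} eq = ⊥-elim (q≢r eq)
        faces-injective {fs fz} {fs (fs (fs fz))} eq = ⊥-elim (q≢s eq)
        faces-injective {fs (fs fz)} {fz} eq = ⊥-elim (p≢r (sym eq))
        faces-injective {fs (fs fz)} {fs fz} eq = ⊥-elim (q≢r (sym eq))
        faces-injective {fs (fs fz)} {fs (fs fz)} _ = refl
        faces-injective {fs (fs fz)} {fs (fs (fs fz))} eq = ⊥-elim (r≢s eq)
        faces-injective {fs (fs (fs fz))} {fz} eq = ⊥-elim (p≢s (sym eq))
        faces-injective {fs (fs (fs fz))} {fs fz} eq = ⊥-elim (q≢s (sym eq))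
        faces-injective {fs (fs (fs fz))} {fs (fs fz)} eq = ⊥-elim (r≢s (sym eq))
        faces-injective {fs (fs (fs fz))} {fs (fs (fs fz))} _ = refl

    boundary-injective : ∀ p q → p ∈ 𝓕 → q ∈ 𝓕 → (∀ e → OnFace G p e → OnFace G q e)
                       → (∀ e → OnFace G q e → OnFace G p e) → p ≡ q
    boundary-injective p q p∈𝓕 q∈𝓕 p⊆q q⊆p with p FP.≟ q
    ... | yes p≡q = p≡q
    ... | no p≢q = ⊥-elim (doubly-covered-empty PQ PQ⊆𝓕 covered p (inj₁ refl))
      where
        PQ : Fin nF → Set
        PQ g = g ≡ p ⊎ g ≡ q
        PQ⊆𝓕 : ∀ g → PQ g → g ∈ 𝓕
        PQ⊆𝓕 g (inj₁ refl) = p∈𝓕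
        PQ⊆𝓕 g (inj₂ refl) = q∈𝓕
        covered : ∀ a e → PQ a → OnFace G a e → ∃[ b ] (PQ b × b ≢ a × OnFace G b e)
        covered a e (inj₁ refl) on = q , inj₂ refl , (λ eq → p≢q (sym eq)) , p⊆q e on
        covered a e (inj₂ refl) on = p , inj₁ refl , p≢q , q⊆p e on

  module EvenFaceCycle (f : Fin nF) (ev : EvenFace G f) where

    L : ℕ
    L = proj₁ ev

    open CyclicOrder L (proj₁ (proj₂ ev)) public

    private
      2∣1+L : 2 ∣ suc L
      2∣1+L = proj₁ (proj₂ (proj₂ ev))

    c : I → Fin nV
    c = proj₁ (proj₂ (proj₂ (proj₂ ev)))

    private
      c-injective : ∀ {i j} → c i ≡ c j → i ≡ j
      c-injective = proj₁ (proj₂ (proj₂ (proj₂ (proj₂ ev))))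

      vertices : ∀ v → VOnFace G f v ⇔ (∃[ i ] c i ≡ v)
      vertices = proj₁ (proj₂ (proj₂ (proj₂ (proj₂ (proj₂ ev)))))

      edge-between : ∀ i j → Succ i j → ∃[ e ] (OnFace G f e × Joins G e (c i) (c j))
      edge-between = proj₁ (proj₂ (proj₂ (proj₂ (proj₂ (proj₂ (proj₂ ev))))))

      edges : ∀ e → OnFace G f e ⇔ (∃[ i ] ∃[ j ] (Succ i j × Joins G e (c i) (c j)))
      edges = proj₂ (proj₂ (proj₂ (proj₂ (proj₂ (proj₂ (proj₂ ev))))))

    vertex-index : ∀ v → VOnFace G f v → ∃[ i ] c i ≡ v
    vertex-index v = fwd (vertices v)

    c-on : ∀ i → VOnFace G f (c i)
    c-on i = bwd (vertices (c i)) (i , refl)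

    edge : I → Fin nE
    edge i = proj₁ (edge-between i (next i) (succ-next i))

    edge-on : ∀ i → OnFace G f (edge i)
    edge-on i = proj₁ (proj₂ (edge-between i (next i) (succ-next i)))

    private
      edge-joins : ∀ i → Joins G (edge i) (c i) (c (next i))
      edge-joins i = proj₂ (proj₂ (edge-between i (next i) (succ-next i)))

    edge-at-start : ∀ i → Inc G (edge i) (c i)
    edge-at-start i = proj₁ (edge-joins i)

    edge-at-end : ∀ i → Inc G (edge i) (c (next i))
    edge-at-end i = proj₁ (proj₂ (edge-joins i))

    edge-before : ∀ i → Inc G (edge (prev i)) (c i)
    edge-before i = subst (λ z → Inc G (edge (prev i)) (c z)) (next-prev i) (edge-at-end (prev i))

    edge-index : ∀ e → OnFace G f e → ∃[ i ] e ≡ edge i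
    edge-index e on with fwd (edges e) on
    ... | i , j , i→j , joins with succ-functional i→j (succ-next i)
    ... | refl = i , no-parallel-edges e (edge i) (c i) (c (next i)) joins (edge-joins i)

    edge-injective : ∀ {i j} → edge i ≡ edge j → i ≡ j
    edge-injective {i} {j} eq
      with two-ends (edge i) (c i) (c (next i)) (c j) (edge-joins i) (subst (λ z → Inc G z (c j)) (sym eq) (edge-at-start j))
    ... | inj₁ cj≡ci = sym (c-injective cj≡ci)
    ... | inj₂ cj≡cnext with c-injective cj≡cnext
    ... | refl with two-ends (edge i) (c i) (c (next i)) (c (next j)) (edge-joins i)
                             (subst (λ z → Inc G z (c (next j))) (sym eq) (edge-at-end j))
    ... | inj₁ b = ⊥-elim (succ-asymmetric (succ-next i) (subst (Succ (next i)) (c-injective b) (succ-next (next i))))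
    ... | inj₂ b = ⊥-elim (succ-irreflexive (subst (Succ (next i)) (c-injective b) (succ-next (next i))))

    prev-edge-≢ : ∀ i → edge (prev i) ≢ edge i
    prev-edge-≢ i eq = succ-irreflexive (subst (λ z → Succ z i) (edge-injective eq) (succ-prev i))

    ends-on-face : ∀ e v → OnFace G f e → Inc G e v → VOnFace G f v
    ends-on-face e v on inc with edge-index e on
    ... | i , refl with two-ends (edge i) (c i) (c (next i)) v (edge-joins i) inc
    ... | inj₁ v≡ci = bwd (vertices v) (i , sym v≡ci)
    ... | inj₂ v≡cnext = bwd (vertices v) (next i , sym v≡cnext)

    edges-at : ∀ e i → OnFace G f e → Inc G e (c i) → e ≡ edge i ⊎ e ≡ edge (prev i)
    edges-at e i on inc with edge-index e on
    ... | j , refl with two-ends (edge j) (c j) (c (next j)) (c i) (edge-joins j) inc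
    ... | inj₁ a = inj₁ (cong edge (sym (c-injective a)))
    ... | inj₂ a = inj₂ (cong edge (succ-injective (subst (Succ j) (sym (c-injective a)) (succ-next j)) (succ-prev i)))

    -- An edge-bit pattern P alternates around the face (a perfect matching of
    -- the boundary cycle).
    Alternating : (Fin nE → Bool) → Set
    Alternating P = ∀ i → P (edge (prev i)) xor P (edge i) ≡ true

    alternating-step : ∀ P → Alternating P → ∀ i → P (edge (next i)) ≡ not (P (edge i))
    alternating-step P alt i =
      xor≡true⇒≡not _ _ (subst (λ z → P (edge z) xor P (edge (next i)) ≡ true) (prev-next i) (alt (next i)))

    alternating-agree : ∀ P Q → Alternating P → Alternating Q → ∀ i₀ → P (edge i₀) ≡ Q (edge i₀)
                      → ∀ e → OnFace G f e → P e ≡ Q e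
    alternating-agree P Q altP altQ i₀ eq₀ e on with edge-index e on
    ... | i , refl = cyclic-induction (λ i → P (edge i) ≡ Q (edge i)) step i₀ eq₀ i
      where
        step : ∀ i → P (edge i) ≡ Q (edge i) → P (edge (next i)) ≡ Q (edge (next i))
        step i eq = trans (alternating-step P altP i) (trans (cong not eq) (sym (alternating-step Q altQ i)))

    -- The reference alternating pattern: the edges at even positions.  It is
    -- kept abstract: only alt₀-edge is needed, and unfolding it is costly.
    abstract
      EvenPosition : Fin nE → I → Set
      EvenPosition e i = e ≡ edge i × isEven (toℕ i) ≡ true

      evenPosition? : ∀ e → Dec (∃ (EvenPosition e))
      evenPosition? e = FP.any? (λ i → (e FP.≟ edge i) Dec.×-dec (isEven (toℕ i) B.≟ true))

      alt₀ : Fin nE → Bool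
      alt₀ e = does (evenPosition? e)

      alt₀-edge : ∀ i → alt₀ (edge i) ≡ isEven (toℕ i)
      alt₀-edge i with isEven (toℕ i) in even-i
      ... | true = dec-true (evenPosition? (edge i)) (i , refl , even-i)
      ... | false = dec-false (evenPosition? (edge i)) λ { (j , eq , even-j) →
            true≢false (trans (sym even-j) (trans (cong (λ z → isEven (toℕ z)) (sym (edge-injective eq))) even-i)) }

    -- It alternates because the cycle is even.
    alt₀-alternating : Alternating alt₀
    alt₀-alternating i rewrite alt₀-edge (prev i) | alt₀-edge i =
      subst (λ z → isEven (toℕ (prev i)) xor isEven (toℕ z) ≡ true) (next-prev i)
        (subst (λ z → isEven (toℕ (prev i)) xor z ≡ true) (sym (isEven-next 2∣1+L (prev i)))
               (BP.xor-inverseʳ (isEven (toℕ (prev i)))))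

    alternating-xor : ∀ P a → Alternating P → Alternating (λ e → P e xor a)
    alternating-xor P a alt i = begin
      (P (edge (prev i)) xor a) xor (P (edge i) xor a) ≡⟨ cong₂ _xor_ (BP.xor-comm _ a) (BP.xor-comm _ a) ⟩
      (a xor P (edge (prev i))) xor (a xor P (edge i)) ≡⟨ xor-shift a _ _ ⟩
      P (edge (prev i)) xor P (edge i)                 ≡⟨ alt i ⟩
      true ∎
      where open ≡-Reasoning

    -- If M ⊕ N = E(f) for perfect matchings M, N, the M-edge at a boundary
    -- vertex lies on the face (otherwise both M and N would match c i twice).
    matched-on-face : ∀ M N → PerfectMatching G M → PerfectMatching G N → (∀ e → SymDiff G M N e ⇔ OnFace G f e)
                    → ∀ i m → m ∈ M → Inc G m (c i) → OnFace G f m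
    matched-on-face M N pmM pmN M⊕N i m m∈M m-at with OnFace? f m
    ... | yes on = on
    ... | no off with pmM (c i) | bwd (M⊕N (edge i)) (edge-on i)
    ... | _ , _ , _ , uniqueM | inj₁ (e∈M , _) =
          ⊥-elim (off (subst (OnFace G f) (trans (uniqueM (edge i) e∈M (edge-at-start i)) (sym (uniqueM m m∈M m-at))) (edge-on i)))
    ... | _ | inj₂ (_ , e∈N) with m SubP.∈? N
    ...   | no m∉N = ⊥-elim (off (fwd (M⊕N m) (inj₁ (m∈M , m∉N))))
    ...   | yes m∈N with pmN (c i)
    ...     | _ , _ , _ , uniqueN =
            ⊥-elim (off (subst (OnFace G f) (trans (uniqueN (edge i) e∈N (edge-at-start i)) (sym (uniqueN m m∈N m-at))) (edge-on i)))

    matching-alternates : ∀ N → PerfectMatching G N → (∀ i m → m ∈ N → Inc G m (c i) → OnFace G f m)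
                        → Alternating (lookup N)
    matching-alternates N pmN stays i with pmN (c i)
    ... | m , m∈N , m-at , unique with edges-at m i (stays i m m∈N m-at) m-at
    ... | inj₁ refl rewrite ∈⇒bit m∈N
                          | ∉⇒bit {x = edge (prev i)} {p = N} (λ p∈N → prev-edge-≢ i (unique _ p∈N (edge-before i))) = refl
    ... | inj₂ refl rewrite ∈⇒bit m∈N
                          | ∉⇒bit {x = edge i} {p = N} (λ e∈N → prev-edge-≢ i (sym (unique _ e∈N (edge-at-start i)))) = refl

module Correspondence (G : EmbeddedGraph) (𝓕 : Subset (EmbeddedGraph.nF G))
                      (even : ∀ f → f ∈ 𝓕 → EvenFace G f) (𝓕≢⊤ : 𝓕 ≢ ⊤) where
  open EmbeddedGraph G
  open Embedded G
  open Independence 𝓕 𝓕≢⊤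

  module Cycle (f : Fin nF) (f∈𝓕 : f ∈ 𝓕) = EvenFaceCycle f (even f f∈𝓕)

  Resonant : Subset nE → Subset nE → Fin nF → Set
  Resonant M N f = ∀ e → SymDiff G M N e ⇔ OnFace G f e

  resonant-sym : ∀ {M N f} → Resonant M N f → Resonant N M f
  resonant-sym {M} {N} M⊕N e = mk⇔ (λ d → fwd (M⊕N e) (swap d)) (λ on → swap (bwd (M⊕N e) on))
    where swap : ∀ {A B} → SymDiff G A B e → SymDiff G B A e
          swap (inj₁ (a , b)) = inj₂ (b , a)
          swap (inj₂ (a , b)) = inj₁ (b , a)

  resonant⇒bits : ∀ M N f → Resonant M N f → ∀ e → lookup M e xor lookup N e ≡ onFace f e
  resonant⇒bits M N f M⊕N e with lookup M e in eM | lookup N e in eN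
  ... | true | false = sym (dec-true (OnFace? f e) (fwd (M⊕N e) (inj₁ (bit⇒∈ eM , bit⇒∉ eN))))
  ... | false | true = sym (dec-true (OnFace? f e) (fwd (M⊕N e) (inj₂ (bit⇒∉ eM , bit⇒∈ eN))))
  ... | true | true = sym (dec-false (OnFace? f e) λ on → case (bwd (M⊕N e) on))
    where case : SymDiff G M N e → ⊥
          case (inj₁ (_ , e∉N)) = e∉N (bit⇒∈ eN)
          case (inj₂ (e∉M , _)) = e∉M (bit⇒∈ eM)
  ... | false | false = sym (dec-false (OnFace? f e) λ on → case (bwd (M⊕N e) on))
    where case : SymDiff G M N e → ⊥
          case (inj₁ (e∈M , _)) = bit⇒∉ eM e∈M
          case (inj₂ (_ , e∈N)) = bit⇒∉ eN e∈N

  bits⇒resonant : ∀ M N f → (∀ e → lookup M e xor lookup N e ≡ onFace f e) → Resonant M N f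
  bits⇒resonant M N f bits e = mk⇔ to from
    where
      to : SymDiff G M N e → OnFace G f e
      to (inj₁ (e∈M , e∉N)) = dec-witness (OnFace? f e) (trans (sym (bits e)) (cong₂ _xor_ (∈⇒bit e∈M) (∉⇒bit e∉N)))
      to (inj₂ (e∉M , e∈N)) = dec-witness (OnFace? f e) (trans (sym (bits e)) (cong₂ _xor_ (∉⇒bit e∉M) (∈⇒bit e∈N)))
      from : OnFace G f e → SymDiff G M N e
      from on = split (lookup M e) (lookup N e) refl refl (trans (bits e) (dec-true (OnFace? f e) on))
        where split : ∀ a b → lookup M e ≡ a → lookup N e ≡ b → a xor b ≡ true → SymDiff G M N e
              split true false eM eN _ = inj₁ (bit⇒∈ eM , bit⇒∉ eN)
              split false true eM eN _ = inj₂ (bit⇒∉ eM , bit⇒∈ eN)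

  resonant-determined : ∀ {M M′ N f} → Resonant M N f → Resonant M′ N f → M ≡ M′
  resonant-determined {M} {M′} {N} {f} M⊕N M′⊕N = vec-ext M M′ λ e →
    xor-cancelʳ (lookup N e) _ _ (trans (resonant⇒bits M N f M⊕N e) (sym (resonant⇒bits M′ N f M′⊕N e)))

  same-bits⇒same-face : ∀ p q → p ∈ 𝓕 → q ∈ 𝓕 → (∀ e → onFace p e ≡ onFace q e) → p ≡ q
  same-bits⇒same-face p q p∈𝓕 q∈𝓕 same = boundary-injective p q p∈𝓕 q∈𝓕 (⊆ p q same) (⊆ q p (λ e → sym (same e)))
    where ⊆ : ∀ a b → (∀ e → onFace a e ≡ onFace b e) → ∀ e → OnFace G a e → OnFace G b e
          ⊆ a b same e on = dec-witness (OnFace? b e) (trans (sym (same e)) (dec-true (OnFace? a e) on))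

  disjoint⇒no-common-edge : ∀ p q → p ∈ 𝓕 → q ∈ 𝓕 → Disjoint p q → ∀ e → OnFace G p e → OnFace G q e → ⊥
  disjoint⇒no-common-edge p q p∈𝓕 q∈𝓕 disj e on-p on-q with some-end e
  ... | v , v-end = disj v (Cycle.ends-on-face p p∈𝓕 e v on-p v-end) (Cycle.ends-on-face q q∈𝓕 e v on-q v-end)

  -- Let A ⊕ B = E(p) and A ⊕ D = B ⊕ C = E(s).  If p and s share a vertex,
  -- then E(p) ⊆ E(s): at a common vertex the A- and B-edges are the two
  -- p-edges there, and both lie on s; so the next p-vertex is on s, and we
  -- go around p.
  shared-vertex⇒⊆ : ∀ A B C D p s → p ∈ 𝓕 → s ∈ 𝓕
                  → PerfectMatching G A → PerfectMatching G B → PerfectMatching G C → PerfectMatching G D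
                  → Resonant A B p → Resonant A D s → Resonant B C s
                  → ∀ v → VOnFace G p v → VOnFace G s v → ∀ e → OnFace G p e → OnFace G s e
  shared-vertex⇒⊆ A B C D p s p∈𝓕 s∈𝓕 pmA pmB pmC pmD A⊕B A⊕D B⊕C v v-p v-s e on =
    on-s (Pc.edge-index e on)
    where
      module Pc = Cycle p p∈𝓕
      module Sc = Cycle s s∈𝓕
      both-edges-on-s : ∀ i → VOnFace G s (Pc.c i) → OnFace G s (Pc.edge i) × OnFace G s (Pc.edge (Pc.prev i))
      both-edges-on-s i c-s with pmA (Pc.c i) | pmB (Pc.c i) | Sc.vertex-index _ c-s
      ... | a , a∈A , a-at , _ | b , b∈B , b-at , _ | j , cj≡ = pick (Pc.edges-at a i a-p a-at) (Pc.edges-at b i b-p b-at)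
        where
          a-p : OnFace G p a
          a-p = Pc.matched-on-face A B pmA pmB A⊕B i a a∈A a-at
          b-p : OnFace G p b
          b-p = Pc.matched-on-face B A pmB pmA (resonant-sym A⊕B) i b b∈B b-at
          a-s : OnFace G s a
          a-s = Sc.matched-on-face A D pmA pmD A⊕D j a a∈A (subst (Inc G a) (sym cj≡) a-at)
          b-s : OnFace G s b
          b-s = Sc.matched-on-face B C pmB pmC B⊕C j b b∈B (subst (Inc G b) (sym cj≡) b-at)
          a∉B : ¬ (a ∈ B)
          a∉B a∈B with bwd (A⊕B a) a-p
          ... | inj₁ (_ , a∉B) = a∉B a∈B
          ... | inj₂ (a∉A , _) = a∉A a∈A
          pick : a ≡ Pc.edge i ⊎ a ≡ Pc.edge (Pc.prev i) → b ≡ Pc.edge i ⊎ b ≡ Pc.edge (Pc.prev i)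
               → OnFace G s (Pc.edge i) × OnFace G s (Pc.edge (Pc.prev i))
          pick (inj₁ a≡) (inj₂ b≡) = subst (OnFace G s) a≡ a-s , subst (OnFace G s) b≡ b-s
          pick (inj₂ a≡) (inj₁ b≡) = subst (OnFace G s) b≡ b-s , subst (OnFace G s) a≡ a-s
          pick (inj₁ a≡) (inj₁ b≡) = ⊥-elim (a∉B (subst (_∈ B) (trans b≡ (sym a≡)) b∈B))
          pick (inj₂ a≡) (inj₂ b≡) = ⊥-elim (a∉B (subst (_∈ B) (trans b≡ (sym a≡)) b∈B))
      all-on-s : ∀ j → VOnFace G s (Pc.c j)
      all-on-s with Pc.vertex-index v v-p
      ... | i₀ , refl = Pc.cyclic-induction (λ i → VOnFace G s (Pc.c i)) step i₀ v-s
        where step : ∀ i → VOnFace G s (Pc.c i) → VOnFace G s (Pc.c (Pc.next i))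
              step i c-s = Sc.ends-on-face (Pc.edge i) _ (proj₁ (both-edges-on-s i c-s)) (Pc.edge-at-end i)
      on-s : ∃[ i ] e ≡ Pc.edge i → OnFace G s e
      on-s (i , refl) = proj₁ (both-edges-on-s i (all-on-s i))

  square : ∀ M₁ M₂ M₃ M₄ p q r s → p ∈ 𝓕 → q ∈ 𝓕 → r ∈ 𝓕 → s ∈ 𝓕
         → PerfectMatching G M₁ → PerfectMatching G M₂ → PerfectMatching G M₃ → PerfectMatching G M₄
         → Resonant M₁ M₂ p → Resonant M₂ M₃ q → Resonant M₄ M₃ r → Resonant M₁ M₄ s
         → M₁ ≢ M₃ → M₂ ≢ M₄
         → p ≡ r × q ≡ s × p ≢ s × Disjoint p s
  square M₁ M₂ M₃ M₄ p q r s p∈𝓕 q∈𝓕 r∈𝓕 s∈𝓕 pm₁ pm₂ pm₃ pm₄ ₁₂ ₂₃ ₄₃ ₁₄ M₁≢M₃ M₂≢M₄ =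
    p≡r , q≡s , p≢s , p-s-disjoint
    where
      boundaries-cancel : ∀ e → onFace p e xor (onFace q e xor (onFace r e xor (onFace s e xor false))) ≡ false
      boundaries-cancel e rewrite sym (resonant⇒bits _ _ _ ₁₂ e) | sym (resonant⇒bits _ _ _ ₂₃ e)
                   | sym (resonant⇒bits _ _ _ ₄₃ e) | sym (resonant⇒bits _ _ _ ₁₄ e) =
        four-cycle-parity (lookup M₁ e) (lookup M₂ e) (lookup M₃ e) (lookup M₄ e)

      -- Adjacent labels differ, since the cycle does not backtrack.
      p≢q : p ≢ q
      p≢q refl = M₁≢M₃ (resonant-determined ₁₂ (resonant-sym ₂₃))
      q≢r : q ≢ r
      q≢r refl = M₂≢M₄ (resonant-determined ₂₃ ₄₃)
      r≢s : r ≢ s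
      r≢s refl = M₁≢M₃ (sym (resonant-determined (resonant-sym ₄₃) ₁₄))
      p≢s : p ≢ s
      p≢s refl = M₂≢M₄ (resonant-determined (resonant-sym ₁₂) (resonant-sym ₁₄))

      -- If one pair of opposite labels coincides, the boundaries of the other
      -- pair cancel, so they coincide too.
      p≡r⇒q≡s : p ≡ r → q ≡ s
      p≡r⇒q≡s p≡r = same-bits⇒same-face q s q∈𝓕 s∈𝓕 λ e →
        even₄-cancel₁₃ (onFace p e) (onFace q e) (onFace s e)
          (subst (λ z → onFace p e xor (onFace q e xor (onFace z e xor (onFace s e xor false))) ≡ false) (sym p≡r)
                 (boundaries-cancel e))

      q≡s⇒p≡r : q ≡ s → p ≡ r
      q≡s⇒p≡r q≡s = same-bits⇒same-face p r p∈𝓕 r∈𝓕 λ e →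
        even₄-cancel₂₄ (onFace p e) (onFace q e) (onFace r e)
          (subst (λ z → onFace p e xor (onFace q e xor (onFace r e xor (onFace z e xor false))) ≡ false) (sym q≡s)
                 (boundaries-cancel e))

      -- Otherwise all four labels would be distinct.
      p≡r×q≡s : p ≡ r × q ≡ s
      p≡r×q≡s with p FP.≟ r | q FP.≟ s
      ... | yes p≡r | _ = p≡r , p≡r⇒q≡s p≡r
      ... | no p≢r | yes q≡s = ⊥-elim (p≢r (q≡s⇒p≡r q≡s))
      ... | no p≢r | no q≢s =
            ⊥-elim (no-four-cancelling p q r s p∈𝓕 q∈𝓕 r∈𝓕 s∈𝓕 p≢q p≢r p≢s q≢r q≢s r≢s boundaries-cancel)

      p≡r : p ≡ r
      p≡r = proj₁ p≡r×q≡s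
      q≡s : q ≡ s
      q≡s = proj₂ p≡r×q≡s

      -- A common vertex would make E(p) = E(s), hence p = s.
      p-s-disjoint : Disjoint p s
      p-s-disjoint v v-p v-s = p≢s (boundary-injective p s p∈𝓕 s∈𝓕
        (shared-vertex⇒⊆ M₁ M₂ M₃ M₄ p s p∈𝓕 s∈𝓕 pm₁ pm₂ pm₃ pm₄ ₁₂ ₁₄
                         (subst (Resonant M₂ M₃) q≡s ₂₃) v v-p v-s)
        (shared-vertex⇒⊆ M₁ M₄ M₃ M₂ s p s∈𝓕 p∈𝓕 pm₁ pm₄ pm₃ pm₂ ₁₄ ₁₂
                         (subst (Resonant M₄ M₃) (sym p≡r) ₄₃) v v-s v-p))

  record ClarData (k : ℕ) (S : Subset nE) : Set where
    field
      g : Fin k → Fin nF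
      g-injective : ∀ {i j} → g i ≡ g j → i ≡ j
      g∈𝓕 : ∀ i → g i ∈ 𝓕
      g-disjoint : ∀ i j → i ≢ j → Disjoint (g i) (g j)
      M : Subset nE
      M-avoids : ∀ e v → e ∈ M → Inc G e v → ∀ i → VOnFace G (g i) v → ⊥
      M-covers : ∀ v → (∃[ i ] VOnFace G (g i) v)
                       ⊎ UniquelyMatched M v
      S-char : ∀ e → e ∈ S ⇔ (e ∈ M ⊎ ∃[ i ] OnFace G (g i) e)

  module MatchingsOfClarCover {k : ℕ} {S : Subset nE} (cd : ClarData k S) where
    open ClarData cd

    module Face (i : Fin k) = Cycle (g i) (g∈𝓕 i)

    e₀ : Fin k → Fin nE
    e₀ i = Face.edge i fz

    e₀-on : ∀ i → OnFace G (g i) (e₀ i)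
    e₀-on i = Face.edge-on i fz

    OnSomeFace : Fin nE → Set
    OnSomeFace e = ∃[ i ] OnFace G (g i) e

    onSomeFace? : ∀ e → Dec (OnSomeFace e)
    onSomeFace? e = FP.any? (λ i → OnFace? (g i) e)

    edge-face-unique : ∀ i j e → OnFace G (g i) e → OnFace G (g j) e → i ≡ j
    edge-face-unique i j e on-i on-j with i FP.≟ j
    ... | yes i≡j = i≡j
    ... | no i≢j = ⊥-elim (disjoint⇒no-common-edge (g i) (g j) (g∈𝓕 i) (g∈𝓕 j) (g-disjoint i j i≢j) e on-i on-j)

    vertex-face-unique : ∀ i j v → VOnFace G (g i) v → VOnFace G (g j) v → i ≡ j
    vertex-face-unique i j v on-i on-j with i FP.≟ j
    ... | yes i≡j = i≡j
    ... | no i≢j = ⊥-elim (g-disjoint i j i≢j v on-i on-j)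

    M-off-faces : ∀ e → e ∈ M → ¬ OnSomeFace e
    M-off-faces e e∈M (i , on) with some-end e
    ... | v , v-end = M-avoids e v e∈M v-end i (Face.ends-on-face i e v on v-end)

    off-faces-agree : ∀ N → PerfectMatching G N → (∀ e → e ∈ N → e ∈ S) → ∀ e → ¬ OnSomeFace e → e ∈ N ⇔ e ∈ M
    off-faces-agree N pmN N⊆S e off = mk⇔ to from
      where
        to : e ∈ N → e ∈ M
        to e∈N with fwd (S-char e) (N⊆S e e∈N)
        ... | inj₁ e∈M = e∈M
        ... | inj₂ on = ⊥-elim (off on)
        from : e ∈ M → e ∈ N
        from e∈M with some-end e
        ... | v , v-end with pmN v
        ... | n , n∈N , n-at , _ with fwd (S-char n) (N⊆S n n∈N)
        ... | inj₂ (i , on) = ⊥-elim (M-avoids e v e∈M v-end i (Face.ends-on-face i n v on n-at))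
        ... | inj₁ n∈M with M-covers v
        ... | inj₁ (i , v-on) = ⊥-elim (M-avoids e v e∈M v-end i v-on)
        ... | inj₂ (_ , _ , _ , unique) = subst (_∈ N) (trans (unique n n∈M n-at) (sym (unique e e∈M v-end))) n∈N

    faces-alternate : ∀ N → PerfectMatching G N → (∀ e → e ∈ N → e ∈ S) → ∀ i → Face.Alternating i (lookup N)
    faces-alternate N pmN N⊆S i = Face.matching-alternates i N pmN stays
      where
        stays : ∀ j m → m ∈ N → Inc G m (Face.c i j) → OnFace G (g i) m
        stays j m m∈N m-at with fwd (S-char m) (N⊆S m m∈N)
        ... | inj₁ m∈M = ⊥-elim (M-avoids m _ m∈M m-at i (Face.c-on i j))
        ... | inj₂ (l , on) = subst (λ z → OnFace G (g z) m) (vertex-face-unique l i _ (Face.ends-on-face l m _ on m-at) (Face.c-on i j)) on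

    determined-by-reference : ∀ N₁ N₂ → PerfectMatching G N₁ → (∀ e → e ∈ N₁ → e ∈ S)
                            → PerfectMatching G N₂ → (∀ e → e ∈ N₂ → e ∈ S)
                            → (∀ i → lookup N₁ (e₀ i) ≡ lookup N₂ (e₀ i)) → N₁ ≡ N₂
    determined-by-reference N₁ N₂ pm₁ N₁⊆S pm₂ N₂⊆S same₀ = subset-ext N₁ N₂ same
      where
        same : ∀ e → e ∈ N₁ ⇔ e ∈ N₂
        same e with onSomeFace? e
        ... | yes (i , on) = mk⇔ (λ m → bit⇒∈ (trans (sym eq) (∈⇒bit m))) (λ m → bit⇒∈ (trans eq (∈⇒bit m)))
          where eq : lookup N₁ e ≡ lookup N₂ e
                eq = Face.alternating-agree i (lookup N₁) (lookup N₂)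
                       (faces-alternate N₁ pm₁ N₁⊆S i) (faces-alternate N₂ pm₂ N₂⊆S i) fz (same₀ i) e on
        ... | no off = mk⇔ (λ m → bwd M₂ (fwd M₁ m)) (λ m → bwd M₁ (fwd M₂ m))
          where M₁ : e ∈ N₁ ⇔ e ∈ M
                M₁ = off-faces-agree N₁ pm₁ N₁⊆S e off
                M₂ : e ∈ N₂ ⇔ e ∈ M
                M₂ = off-faces-agree N₂ pm₂ N₂⊆S e off

    -- φ a ∈ {0,1}^k ↦ the perfect matching consisting of M and, on each face
    -- gᵢ, the reference alternating matching xor aᵢ.  Kept abstract; it is
    -- used only through φ-on and φ-off.
    abstract
      Chosen : Vec Bool k → Fin nE → Fin k → Set
      Chosen a e i = OnFace G (g i) e × (Face.alt₀ i e xor lookup a i ≡ true)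

      chosen? : ∀ a e → Dec (∃ (Chosen a e))
      chosen? a e = FP.any? (λ i → OnFace? (g i) e Dec.×-dec ((Face.alt₀ i e xor lookup a i) B.≟ true))

      φ : Vec Bool k → Subset nE
      φ a = tabulate (λ e → lookup M e ∨ does (chosen? a e))

      φ-on : ∀ a i e → OnFace G (g i) e → lookup (φ a) e ≡ Face.alt₀ i e xor lookup a i
      φ-on a i e on rewrite VP.lookup∘tabulate (λ e → lookup M e ∨ does (chosen? a e)) e
                          | ∉⇒bit {x = e} {p = M} (λ e∈M → M-off-faces e e∈M (i , on))
        with Face.alt₀ i e xor lookup a i in eq
      ... | true = dec-true (chosen? a e) (i , on , eq)
      ... | false = dec-false (chosen? a e) λ { (j , on-j , t) →
              true≢false (trans (sym t) (trans (cong (λ z → Face.alt₀ z e xor lookup a z) (edge-face-unique j i e on-j on)) eq)) }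

      φ-off : ∀ a e → ¬ OnSomeFace e → lookup (φ a) e ≡ lookup M e
      φ-off a e off rewrite VP.lookup∘tabulate (λ e → lookup M e ∨ does (chosen? a e)) e
                          | dec-false (chosen? a e) (λ { (i , on , _) → off (i , on) }) = BP.∨-identityʳ (lookup M e)

    φ⊆S : ∀ a e → e ∈ φ a → e ∈ S
    φ⊆S a e e∈φ with onSomeFace? e
    ... | yes on = bwd (S-char e) (inj₂ on)
    ... | no off = bwd (S-char e) (inj₁ (bit⇒∈ (trans (sym (φ-off a e off)) (∈⇒bit e∈φ))))

    φ-flip : ∀ a j e → lookup (φ (flip j a)) e ≡ lookup (φ a) e xor onFace (g j) e
    φ-flip a j e with onSomeFace? e
    ... | no off rewrite φ-off (flip j a) e off | φ-off a e off | dec-false (OnFace? (g j) e) (λ on → off (j , on)) =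
          sym (BP.xor-identityʳ (lookup M e))
    ... | yes (i , on) rewrite φ-on (flip j a) i e on | φ-on a i e on with i FP.≟ j
    ...   | yes refl rewrite flip-same i a | dec-true (OnFace? (g i) e) on =
            trans (sym (BP.not-distribʳ-xor (Face.alt₀ i e) (lookup a i))) (BP.xor-comm true _)
    ...   | no i≢j rewrite flip-other i j a i≢j | dec-false (OnFace? (g j) e) (λ on-j → i≢j (edge-face-unique i j e on on-j)) =
            sym (BP.xor-identityʳ _)

    -- a is read off from φ a at the reference edges.
    φ-injective : ∀ a b → φ a ≡ φ b → a ≡ b
    φ-injective a b eq = vec-ext a b λ i → xor-cancelˡ (Face.alt₀ i (e₀ i)) _ _ (begin
      Face.alt₀ i (e₀ i) xor lookup a i ≡⟨ sym (φ-on a i (e₀ i) (e₀-on i)) ⟩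
      lookup (φ a) (e₀ i)               ≡⟨ cong (λ z → lookup z (e₀ i)) eq ⟩
      lookup (φ b) (e₀ i)               ≡⟨ φ-on b i (e₀ i) (e₀-on i) ⟩
      Face.alt₀ i (e₀ i) xor lookup b i ∎)
      where open ≡-Reasoning

    sole-edge-at : ∀ a i j e o → OnFace G (g i) e → Inc G e (Face.c i j)
                 → (∀ e′ → OnFace G (g i) e′ → Inc G e′ (Face.c i j) → e′ ≡ e ⊎ e′ ≡ o)
                 → Face.alt₀ i e xor lookup a i ≡ true → Face.alt₀ i o xor lookup a i ≡ false
                 → UniquelyMatched (φ a) (Face.c i j)
    sole-edge-at a i j e o on at face-edges-at e-in o-out = e , bit⇒∈ (trans (φ-on a i e on) e-in) , at , unique
      where
        unique : ∀ e′ → e′ ∈ φ a → Inc G e′ (Face.c i j) → e′ ≡ e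
        unique e′ e′∈φ e′-at with onSomeFace? e′
        ... | no off = ⊥-elim (M-avoids e′ _ (bit⇒∈ (trans (sym (φ-off a e′ off)) (∈⇒bit e′∈φ))) e′-at i (Face.c-on i j))
        ... | yes (l , on′) with vertex-face-unique l i _ (Face.ends-on-face l e′ _ on′ e′-at) (Face.c-on i j)
        ... | refl with face-edges-at e′ on′ e′-at
        ... | inj₁ e′≡e = e′≡e
        ... | inj₂ refl = ⊥-elim (true≢false (trans (sym (∈⇒bit e′∈φ)) (trans (φ-on a i e′ on′) o-out)))

    -- Since φ a alternates on gᵢ, exactly one face edge at c j is in φ a.
    φ-perfect-on-face : ∀ a i j → UniquelyMatched (φ a) (Face.c i j)
    φ-perfect-on-face a i j
      with xor≡true-split (Face.alternating-xor i (Face.alt₀ i) (lookup a i) (Face.alt₀-alternating i) j)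
    ... | inj₁ (in-before , out-after) =
          sole-edge-at a i j (Face.edge i (Face.prev i j)) (Face.edge i j) (Face.edge-on i _) (Face.edge-before i j)
                       (λ e′ on at → S.swap (Face.edges-at i e′ j on at)) in-before out-after
    ... | inj₂ (out-before , in-after) =
          sole-edge-at a i j (Face.edge i j) (Face.edge i (Face.prev i j)) (Face.edge-on i j) (Face.edge-at-start i j)
                       (λ e′ on at → Face.edges-at i e′ j on at) in-after out-before

    φ-perfect : ∀ a → PerfectMatching G (φ a)
    φ-perfect a v with M-covers v
    ... | inj₂ (m , m∈M , m-at , unique) =
          m , bit⇒∈ (trans (φ-off a m (M-off-faces m m∈M)) (∈⇒bit m∈M)) , m-at , unique′
      where
        unique′ : ∀ e′ → e′ ∈ φ a → Inc G e′ v → e′ ≡ m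
        unique′ e′ e′∈φ e′-at with onSomeFace? e′
        ... | yes (l , on) = ⊥-elim (M-avoids m v m∈M m-at l (Face.ends-on-face l e′ v on e′-at))
        ... | no off = unique e′ (bit⇒∈ (trans (sym (φ-off a e′ off)) (∈⇒bit e′∈φ))) e′-at
    ... | inj₁ (i , v-on) with Face.vertex-index i v v-on
    ...   | j , refl = φ-perfect-on-face a i j

    coordinates : Subset nE → Vec Bool k
    coordinates N = tabulate (λ i → Face.alt₀ i (e₀ i) xor lookup N (e₀ i))

    φ-onto : ∀ N → PerfectMatching G N → (∀ e → e ∈ N → e ∈ S) → N ≡ φ (coordinates N)
    φ-onto N pmN N⊆S = determined-by-reference N (φ (coordinates N)) pmN N⊆S (φ-perfect _) (φ⊆S _) same₀
      where
        same₀ : ∀ i → lookup N (e₀ i) ≡ lookup (φ (coordinates N)) (e₀ i)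
        same₀ i = sym (begin
          lookup (φ (coordinates N)) (e₀ i)                       ≡⟨ φ-on _ i (e₀ i) (e₀-on i) ⟩
          Face.alt₀ i (e₀ i) xor lookup (coordinates N) i         ≡⟨ cong (Face.alt₀ i (e₀ i) xor_) (VP.lookup∘tabulate _ i) ⟩
          Face.alt₀ i (e₀ i) xor (Face.alt₀ i (e₀ i) xor lookup N (e₀ i)) ≡⟨ xor-absorb (Face.alt₀ i (e₀ i)) _ ⟩
          lookup N (e₀ i) ∎)
          where open ≡-Reasoning

    φ-resonant : ∀ a j → Resonant (φ a) (φ (flip j a)) (g j)
    φ-resonant a j = bits⇒resonant (φ a) (φ (flip j a)) (g j)
      (λ e → trans (cong (lookup (φ a) e xor_) (φ-flip a j e)) (xor-absorb (lookup (φ a) e) (onFace (g j) e)))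

    φ-xor-on : ∀ a b i e → OnFace G (g i) e → lookup (φ a) e xor lookup (φ b) e ≡ lookup a i xor lookup b i
    φ-xor-on a b i e on rewrite φ-on a i e on | φ-on b i e on = xor-shift (Face.alt₀ i e) (lookup a i) (lookup b i)

    φ-xor-off : ∀ a b e → ¬ OnSomeFace e → lookup (φ a) e xor lookup (φ b) e ≡ false
    φ-xor-off a b e off rewrite φ-off a e off | φ-off b e off = BP.xor-same (lookup M e)

    -- A face of 𝓕 whose boundary is the union of boundaries of some of the gᵢ
    -- is itself one of the gᵢ: otherwise it and those gᵢ would form a doubly
    -- covered family.
    union-of-faces-is-a-face : ∀ h → h ∈ 𝓕 → (D : Fin k → Set)
                             → (∀ e → OnFace G h e → ∃[ d ] (D d × OnFace G (g d) e))
                             → (∀ d e → D d → OnFace G (g d) e → OnFace G h e)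
                             → ∃[ l ] g l ≡ h
    union-of-faces-is-a-face h h∈𝓕 D h⊆ ⊆h with FP.any? (λ l → g l FP.≟ h)
    ... | yes found = found
    ... | no none = ⊥-elim (doubly-covered-empty Family Family⊆𝓕 covered h (inj₁ refl))
      where
        Family : Fin nF → Set
        Family x = x ≡ h ⊎ ∃[ d ] (D d × g d ≡ x)
        Family⊆𝓕 : ∀ x → Family x → x ∈ 𝓕
        Family⊆𝓕 x (inj₁ refl) = h∈𝓕
        Family⊆𝓕 x (inj₂ (d , _ , refl)) = g∈𝓕 d
        covered : ∀ x e → Family x → OnFace G x e → ∃[ y ] (Family y × y ≢ x × OnFace G y e)
        covered x e (inj₁ refl) on with h⊆ e on
        ... | d , Dd , on-d = g d , inj₂ (d , Dd , refl) , (λ eq → none (d , eq)) , on-d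
        covered x e (inj₂ (d , Dd , refl)) on = h , inj₁ refl , (λ eq → none (d , sym eq)) , ⊆h d e Dd on

    resonant⇒flip : ∀ a b h → h ∈ 𝓕 → Resonant (φ a) (φ b) h → ∃[ l ] b ≡ flip l a
    resonant⇒flip a b h h∈𝓕 φa⊕φb = l , vec-ext b (flip l a) coordinate
      where
        Differ : Fin k → Set
        Differ d = lookup a d xor lookup b d ≡ true
        bits : ∀ e → lookup (φ a) e xor lookup (φ b) e ≡ onFace h e
        bits = resonant⇒bits (φ a) (φ b) h φa⊕φb
        h⊆ : ∀ e → OnFace G h e → ∃[ d ] (Differ d × OnFace G (g d) e)
        h⊆ e on with onSomeFace? e
        ... | yes (d , on-d) = d , trans (sym (φ-xor-on a b d e on-d)) (trans (bits e) (dec-true (OnFace? h e) on)) , on-d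
        ... | no off = ⊥-elim (true≢false (trans (sym (dec-true (OnFace? h e) on)) (trans (sym (bits e)) (φ-xor-off a b e off))))
        ⊆h : ∀ d e → Differ d → OnFace G (g d) e → OnFace G h e
        ⊆h d e differ on = dec-witness (OnFace? h e) (trans (sym (bits e)) (trans (φ-xor-on a b d e on) differ))
        found : ∃[ l ] g l ≡ h
        found = union-of-faces-is-a-face h h∈𝓕 Differ h⊆ ⊆h
        l : Fin k
        l = proj₁ found
        gl≡h : g l ≡ h
        gl≡h = proj₂ found
        only-l : ∀ d → Differ d → d ≡ l
        only-l d differ = edge-face-unique d l (e₀ d) (e₀-on d)
                            (subst (λ z → OnFace G z (e₀ d)) (sym gl≡h) (⊆h d (e₀ d) differ (e₀-on d)))
        differs-at-l : Differ l
        differs-at-l with h⊆ (e₀ l) (subst (λ z → OnFace G z (e₀ l)) gl≡h (e₀-on l))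
        ... | d , differ , _ = subst Differ (only-l d differ) differ
        coordinate : ∀ i → lookup b i ≡ lookup (flip l a) i
        coordinate i with i FP.≟ l
        ... | yes refl = trans (xor≡true⇒≡not _ _ differs-at-l) (sym (flip-same i a))
        ... | no i≢l = trans (sym (xor≢true⇒≡ _ _ (λ differ → i≢l (only-l i differ)))) (sym (flip-other i l a i≢l))

    φ-adjacent : ∀ a b → ResAdj G 𝓕 (φ a) (φ b) ⇔ QAdj a b
    φ-adjacent a b = mk⇔ to from
      where
        to : ResAdj G 𝓕 (φ a) (φ b) → QAdj a b
        to (h , h∈𝓕 , φa⊕φb) with resonant⇒flip a b h h∈𝓕 φa⊕φb
        ... | l , refl = qadj-flip l a
        from : QAdj a b → ResAdj G 𝓕 (φ a) (φ b)
        from adj with qadj⇒flip a b adj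
        ... | j , refl = g j , g∈𝓕 j , φ-resonant a j

    ∈S⇒∈φ : ∀ e → e ∈ S → ∃[ a ] e ∈ φ a
    ∈S⇒∈φ e e∈S with fwd (S-char e) e∈S
    ... | inj₁ e∈M = origin , bit⇒∈ (trans (φ-off origin e (M-off-faces e e∈M)) (∈⇒bit e∈M))
      where origin = V.replicate k false
    ... | inj₂ (i , on) with lookup (φ (V.replicate k false)) e in eq
    ...   | true = V.replicate k false , bit⇒∈ eq
    ...   | false = flip i (V.replicate k false) ,
                    bit⇒∈ (trans (φ-flip _ i e) (trans (cong (_xor onFace (g i) e) eq) (dec-true (OnFace? (g i) e) on)))

  module ClarCoverOfCube {k : ℕ} (U : SubsetFamily nE) (cube : InducedCube G 𝓕 k U) where

    ψ : Vec Bool k → Subset nE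
    ψ = proj₁ (proj₂ cube)

    ψ∈U : ∀ a → ψ a ∈ᶠ U
    ψ∈U = proj₁ (proj₂ (proj₂ cube))

    ψ-onto : ∀ N → N ∈ᶠ U → ∃[ a ] ψ a ≡ N
    ψ-onto = proj₁ (proj₂ (proj₂ (proj₂ cube)))

    private
      ψ-injective : ∀ {a b} → ψ a ≡ ψ b → a ≡ b
      ψ-injective = proj₁ (proj₂ (proj₂ (proj₂ (proj₂ cube))))

      ψ-adjacent : ∀ a b → ResAdj G 𝓕 (ψ a) (ψ b) ⇔ QAdj a b
      ψ-adjacent = proj₂ (proj₂ (proj₂ (proj₂ (proj₂ cube))))

    ψ-perfect : ∀ a → PerfectMatching G (ψ a)
    ψ-perfect a = proj₁ cube _ (ψ∈U a)

    origin : Vec Bool k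
    origin = V.replicate k false

    ψ₀ : Subset nE
    ψ₀ = ψ origin

    edge-resonance : ∀ a i → ResAdj G 𝓕 (ψ a) (ψ (flip i a))
    edge-resonance a i = bwd (ψ-adjacent a (flip i a)) (qadj-flip i a)

    label : Fin k → Fin nF
    label i = proj₁ (edge-resonance origin i)

    label∈𝓕 : ∀ i → label i ∈ 𝓕
    label∈𝓕 i = proj₁ (proj₂ (edge-resonance origin i))

    Labelled : Vec Bool k → Set
    Labelled a = ∀ i → Resonant (ψ a) (ψ (flip i a)) (label i)

    cube-square : ∀ a i j → i ≢ j → Resonant (ψ a) (ψ (flip i a)) (label i)
                → Resonant (ψ (flip j a)) (ψ (flip i (flip j a))) (label i)
                  × label i ≢ proj₁ (edge-resonance a j) × Disjoint (label i) (proj₁ (edge-resonance a j))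
    cube-square a i j i≢j ψa⊕ψia with edge-resonance (flip i a) j | edge-resonance (flip j a) i | edge-resonance a j
    ... | q , q∈𝓕 , ₂₃ | r , r∈𝓕 , ₄₃ | s , s∈𝓕 , ₁₄ with
      square (ψ a) (ψ (flip i a)) (ψ (flip i (flip j a))) (ψ (flip j a)) (label i) q r s
             (label∈𝓕 i) q∈𝓕 r∈𝓕 s∈𝓕 (ψ-perfect _) (ψ-perfect _) (ψ-perfect _) (ψ-perfect _)
             ψa⊕ψia (subst (λ z → Resonant (ψ (flip i a)) (ψ z) q) (flip-comm j i a) ₂₃) ₄₃ ₁₄
             (λ eq → flip₂-≢ i j a i≢j (sym (ψ-injective eq)))
             (λ eq → flip₂-≢ j i a (λ e → i≢j (sym e)) (trans (cong (flip j) (ψ-injective eq)) (flip-involutive j a)))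
    ... | p≡r , _ , p≢s , disjoint = subst (Resonant (ψ (flip j a)) (ψ (flip i (flip j a)))) (sym p≡r) ₄₃ , p≢s , disjoint

    labelled : ∀ a → Labelled a
    labelled = cube-induction Labelled (λ i → proj₂ (proj₂ (edge-resonance origin i))) step
      where
        step : ∀ a j → Labelled a → Labelled (flip j a)
        step a j La i with i FP.≟ j
        ... | yes refl = subst (λ z → Resonant (ψ (flip i a)) (ψ z) (label i)) (sym (flip-involutive i a)) (resonant-sym (La i))
        ... | no i≢j = proj₁ (cube-square a i j i≢j (La i))

    labels-disjoint : ∀ i j → i ≢ j → label i ≢ label j × Disjoint (label i) (label j)
    labels-disjoint i j i≢j with cube-square origin i j i≢j (labelled origin i)
    ... | _ , ≢ , disjoint = ≢ , disjoint

    label-injective : ∀ {i j} → label i ≡ label j → i ≡ j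
    label-injective {i} {j} eq with i FP.≟ j
    ... | yes i≡j = i≡j
    ... | no i≢j = ⊥-elim (proj₁ (labels-disjoint i j i≢j) eq)

    OnSomeLabel : Fin nE → Set
    OnSomeLabel e = ∃[ i ] OnFace G (label i) e

    onSomeLabel? : ∀ e → Dec (OnSomeLabel e)
    onSomeLabel? e = FP.any? (λ i → OnFace? (label i) e)

    off-labels : ∀ e → ¬ OnSomeLabel e → ∀ a → lookup (ψ a) e ≡ lookup ψ₀ e
    off-labels e off = cube-induction (λ a → lookup (ψ a) e ≡ lookup ψ₀ e) refl step
      where
        step : ∀ a j → lookup (ψ a) e ≡ lookup ψ₀ e → lookup (ψ (flip j a)) e ≡ lookup ψ₀ e
        step a j eq = trans (sym (xor≡false⇒≡ _ _ (trans (resonant⇒bits _ _ _ (labelled a j) e)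
                                   (dec-false (OnFace? (label j) e) (λ on → off (j , on)))))) eq

    on-label : ∀ e i → OnFace G (label i) e → ∀ a → lookup (ψ a) e ≡ lookup ψ₀ e xor lookup a i
    on-label e i on = cube-induction (λ a → lookup (ψ a) e ≡ lookup ψ₀ e xor lookup a i) base step
      where
        base : lookup ψ₀ e ≡ lookup ψ₀ e xor lookup origin i
        base rewrite VP.lookup-replicate i false = sym (BP.xor-identityʳ _)
        flips-with : ∀ a j → lookup (ψ a) e xor lookup (ψ (flip j a)) e ≡ onFace (label j) e
        flips-with a j = resonant⇒bits _ _ _ (labelled a j) e
        step : ∀ a j → lookup (ψ a) e ≡ lookup ψ₀ e xor lookup a i
             → lookup (ψ (flip j a)) e ≡ lookup ψ₀ e xor lookup (flip j a) i
        step a j eq with j FP.≟ i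
        ... | yes refl = begin
          lookup (ψ (flip j a)) e         ≡⟨ xor≡true⇒≡not _ _ (trans (flips-with a j) (dec-true (OnFace? (label j) e) on)) ⟩
          not (lookup (ψ a) e)            ≡⟨ cong not eq ⟩
          not (lookup ψ₀ e xor lookup a j) ≡⟨ BP.not-distribʳ-xor (lookup ψ₀ e) (lookup a j) ⟩
          lookup ψ₀ e xor not (lookup a j) ≡⟨ cong (lookup ψ₀ e xor_) (sym (flip-same j a)) ⟩
          lookup ψ₀ e xor lookup (flip j a) j ∎
          where open ≡-Reasoning
        ... | no j≢i = begin
          lookup (ψ (flip j a)) e          ≡⟨ sym (xor≡false⇒≡ _ _ (trans (flips-with a j)
                                                 (dec-false (OnFace? (label j) e) not-on-j))) ⟩
          lookup (ψ a) e                   ≡⟨ eq ⟩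
          lookup ψ₀ e xor lookup a i       ≡⟨ cong (lookup ψ₀ e xor_) (sym (flip-other i j a (λ eq → j≢i (sym eq)))) ⟩
          lookup ψ₀ e xor lookup (flip j a) i ∎
          where
            open ≡-Reasoning
            not-on-j : ¬ OnFace G (label j) e
            not-on-j on-j = disjoint⇒no-common-edge (label i) (label j) (label∈𝓕 i) (label∈𝓕 j)
                              (proj₂ (labels-disjoint i j (λ eq → j≢i (sym eq)))) e on on-j

    M : Subset nE
    M = tabulate (λ e → lookup ψ₀ e ∧ not (does (onSomeLabel? e)))

    M-char : ∀ e → e ∈ M ⇔ (e ∈ ψ₀ × ¬ OnSomeLabel e)
    M-char e = mk⇔ (split (lookup ψ₀ e) (onSomeLabel? e) refl ∘′ trans (sym bit) ∘′ ∈⇒bit)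
                   (λ (e∈ψ₀ , off) → bit⇒∈ (trans bit
                      (cong₂ (λ x y → x ∧ not y) (∈⇒bit e∈ψ₀) (dec-false (onSomeLabel? e) off))))
      where
        bit : lookup M e ≡ lookup ψ₀ e ∧ not (does (onSomeLabel? e))
        bit = VP.lookup∘tabulate _ e
        split : ∀ b (d : Dec (OnSomeLabel e)) → lookup ψ₀ e ≡ b → b ∧ not (does d) ≡ true → e ∈ ψ₀ × ¬ OnSomeLabel e
        split true (no off) eq _ = bit⇒∈ eq , off

    -- The label faces avoid M: at a vertex of label i the ψ₀-edge is a face edge.
    M-avoids : ∀ e v → e ∈ M → Inc G e v → ∀ i → VOnFace G (label i) v → ⊥
    M-avoids e v e∈M e-at i v-on with Cycle.vertex-index (label i) (label∈𝓕 i) v v-on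
    ... | j , refl with fwd (M-char e) e∈M
    ... | e∈ψ₀ , off = off (i , Cycle.matched-on-face (label i) (label∈𝓕 i) ψ₀ (ψ (flip i origin))
                                 (ψ-perfect _) (ψ-perfect _) (labelled origin i) j e e∈ψ₀ e-at)

    M-covers : ∀ v → (∃[ i ] VOnFace G (label i) v)
                     ⊎ UniquelyMatched M v
    M-covers v with FP.any? (λ i → VOnFace? (label i) v)
    ... | yes on = inj₁ on
    ... | no off with ψ-perfect origin v
    ... | m , m∈ψ₀ , m-at , unique =
          inj₂ (m , bwd (M-char m) (m∈ψ₀ , λ (i , on) → off (i , Cycle.ends-on-face (label i) (label∈𝓕 i) m v on m-at)) , m-at ,
                λ e′ e′∈M e′-at → unique e′ (proj₁ (fwd (M-char e′) e′∈M)) e′-at)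

    ⋃-char : ∀ e → e ∈ ⋃ U ⇔ (e ∈ M ⊎ OnSomeLabel e)
    ⋃-char e = mk⇔ to from
      where
        to : e ∈ ⋃ U → e ∈ M ⊎ OnSomeLabel e
        to e∈⋃ with onSomeLabel? e
        ... | yes on = inj₂ on
        ... | no off with ∈⋃⇒ U e e∈⋃
        ... | N , N∈U , e∈N with ψ-onto N N∈U
        ... | a , refl = inj₁ (bwd (M-char e) (bit⇒∈ (trans (sym (off-labels e off a)) (∈⇒bit e∈N)) , off))
        from : e ∈ M ⊎ OnSomeLabel e → e ∈ ⋃ U
        from (inj₁ e∈M) = ⇒∈⋃ U e ψ₀ (ψ∈U origin) (proj₁ (fwd (M-char e) e∈M))
        from (inj₂ (i , on)) with lookup ψ₀ e in eq
        ... | true = ⇒∈⋃ U e ψ₀ (ψ∈U origin) (bit⇒∈ eq)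
        ... | false = ⇒∈⋃ U e (ψ (flip i origin)) (ψ∈U _) (bit⇒∈ (begin
          lookup (ψ (flip i origin)) e                   ≡⟨ cong (_xor lookup (ψ (flip i origin)) e) (sym eq) ⟩
          lookup ψ₀ e xor lookup (ψ (flip i origin)) e   ≡⟨ resonant⇒bits _ _ _ (labelled origin i) e ⟩
          onFace (label i) e                             ≡⟨ dec-true (OnFace? (label i) e) on ⟩
          true ∎))
          where open ≡-Reasoning

    clarData : ClarData k (⋃ U)
    clarData = record
      { g = label ; g-injective = label-injective ; g∈𝓕 = label∈𝓕
      ; g-disjoint = λ i j i≢j → proj₂ (labels-disjoint i j i≢j)
      ; M = M ; M-avoids = M-avoids ; M-covers = M-covers ; S-char = ⋃-char }

  clarCover⇒clarData : ∀ {k S} → ClarCover G 𝓕 k S → ClarData k S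
  clarCover⇒clarData {k} {S} (K , K⊆𝓕 , refl , _ , K-disjoint , M , avoids , covers , S-char) with enumerate K
  ... | g , g-inj , g∈K , g-onto = record
      { g = g ; g-injective = g-inj ; g∈𝓕 = λ i → K⊆𝓕 (g∈K i)
      ; g-disjoint = λ i j i≢j → K-disjoint (g i) (g j) (g∈K i) (g∈K j) (λ eq → i≢j (g-inj eq))
      ; M = M ; M-avoids = λ e v e∈M e-at i → avoids e v e∈M e-at (g i) (g∈K i)
      ; M-covers = covers′ ; S-char = S-char′ }
    where
      covers′ : ∀ v → (∃[ i ] VOnFace G (g i) v) ⊎ UniquelyMatched M v
      covers′ v with covers v
      ... | inj₂ matched = inj₂ matched
      ... | inj₁ (f , f∈K , v-on) with g-onto f f∈K
      ...   | i , refl = inj₁ (i , v-on)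
      S-char′ : ∀ e → e ∈ S ⇔ (e ∈ M ⊎ ∃[ i ] OnFace G (g i) e)
      S-char′ e = mk⇔ to from
        where
          to : e ∈ S → e ∈ M ⊎ ∃[ i ] OnFace G (g i) e
          to e∈S with fwd (S-char e) e∈S
          ... | inj₁ e∈M = inj₁ e∈M
          ... | inj₂ (f , f∈K , on) with g-onto f f∈K
          ...   | i , refl = inj₂ (i , on)
          from : e ∈ M ⊎ ∃[ i ] OnFace G (g i) e → e ∈ S
          from (inj₁ e∈M) = bwd (S-char e) (inj₁ e∈M)
          from (inj₂ (i , on)) = bwd (S-char e) (inj₂ (g i , g∈K i , on))

  clarData⇒clarCover : ∀ {k S} → ClarData k S → ClarCover G 𝓕 k S
  clarData⇒clarCover {k} {S} cd =
    K , K⊆𝓕 , ∣p∣≡size-of-enumeration K g g-injective (λ i → bwd ∈K (i , refl)) (λ f f∈K → fwd ∈K f∈K) ,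
    (λ f f∈K → even f (K⊆𝓕 f∈K)) , K-disjoint , M , avoids , covers , S-char′
    where
      open ClarData cd
      K : Subset nF
      K = tabulate (λ f → does (FP.any? (λ i → g i FP.≟ f)))
      ∈K : ∀ {f} → f ∈ K ⇔ (∃[ i ] g i ≡ f)
      ∈K {f} = mk⇔ (λ f∈K → dec-witness (FP.any? (λ i → g i FP.≟ f)) (trans (sym (VP.lookup∘tabulate _ f)) (∈⇒bit f∈K)))
                   (λ found → bit⇒∈ (trans (VP.lookup∘tabulate _ f) (dec-true (FP.any? (λ i → g i FP.≟ f)) found)))
      K⊆𝓕 : ∀ {f} → f ∈ K → f ∈ 𝓕
      K⊆𝓕 f∈K with fwd ∈K f∈K
      ... | i , refl = g∈𝓕 i
      K-disjoint : ∀ f h → f ∈ K → h ∈ K → f ≢ h → Disjoint f h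
      K-disjoint f h f∈K h∈K f≢h with fwd ∈K f∈K | fwd ∈K h∈K
      ... | i , refl | j , refl = g-disjoint i j (λ eq → f≢h (cong g eq))
      avoids : ∀ e v → e ∈ M → Inc G e v → ∀ f → f ∈ K → VOnFace G f v → ⊥
      avoids e v e∈M e-at f f∈K v-on with fwd ∈K f∈K
      ... | i , refl = M-avoids e v e∈M e-at i v-on
      covers : ∀ v → (∃[ f ] (f ∈ K × VOnFace G f v)) ⊎ UniquelyMatched M v
      covers v = S.map₁ (λ (i , v-on) → g i , bwd ∈K (i , refl) , v-on) (M-covers v)
      S-char′ : ∀ e → e ∈ S ⇔ (e ∈ M ⊎ ∃[ f ] (f ∈ K × OnFace G f e))
      S-char′ e = mk⇔ (S.map₂ (λ (i , on) → g i , bwd ∈K (i , refl) , on) ∘′ fwd (S-char e)) from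
        where
          from : e ∈ M ⊎ ∃[ f ] (f ∈ K × OnFace G f e) → e ∈ S
          from (inj₁ e∈M) = bwd (S-char e) (inj₁ e∈M)
          from (inj₂ (f , f∈K , on)) with fwd ∈K f∈K
          ... | i , refl = bwd (S-char e) (inj₂ (i , on))

  PerfectMatching? : ∀ N → Dec (PerfectMatching G N)
  PerfectMatching? N = FP.all? λ v → FP.any? λ e → (e SubP.∈? N) Dec.×-dec ((Inc? e v) Dec.×-dec
                         FP.all? (λ e′ → (e′ SubP.∈? N) Dec.→-dec ((Inc? e′ v) Dec.→-dec (e′ FP.≟ e))))

  matchingsIn : Subset nE → SubsetFamily nE
  matchingsIn S = family (λ N → does ((N SubP.⊆? S) Dec.×-dec PerfectMatching? N))

  ∈matchingsIn : ∀ {S N} → N ∈ᶠ matchingsIn S ⇔ (N Sub.⊆ S × PerfectMatching G N)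
  ∈matchingsIn {S} {N} = mk⇔ (dec-witness ((N SubP.⊆? S) Dec.×-dec PerfectMatching? N) ∘′ fwd (∈-family _ N))
                             (bwd (∈-family _ N) ∘′ dec-true ((N SubP.⊆? S) Dec.×-dec PerfectMatching? N))

  matchingsIn-cube : ∀ {k S} → ClarData k S → InducedCube G 𝓕 k (matchingsIn S)
  matchingsIn-cube {k} {S} cd =
    (λ N N∈ → proj₂ (fwd ∈matchingsIn N∈)) , φ , φ∈ , onto , (λ {a} {b} → φ-injective a b) , φ-adjacent
    where
      open MatchingsOfClarCover cd
      φ∈ : ∀ a → φ a ∈ᶠ matchingsIn S
      φ∈ a = bwd ∈matchingsIn ((λ {e} → φ⊆S a e) , φ-perfect a)
      onto : ∀ N → N ∈ᶠ matchingsIn S → ∃[ a ] φ a ≡ N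
      onto N N∈ with fwd ∈matchingsIn N∈
      ... | N⊆S , pmN = coordinates N , sym (φ-onto N pmN (λ e → N⊆S))

  ⋃-matchingsIn : ∀ {k S} → ClarData k S → ⋃ (matchingsIn S) ≡ S
  ⋃-matchingsIn {k} {S} cd = subset-ext (⋃ (matchingsIn S)) S λ e → mk⇔ (to e) (from e)
    where
      open MatchingsOfClarCover cd
      to : ∀ e → e ∈ ⋃ (matchingsIn S) → e ∈ S
      to e e∈⋃ with ∈⋃⇒ (matchingsIn S) e e∈⋃
      ... | N , N∈ , e∈N = proj₁ (fwd ∈matchingsIn N∈) e∈N
      from : ∀ e → e ∈ S → e ∈ ⋃ (matchingsIn S)
      from e e∈S with ∈S⇒∈φ e e∈S
      ... | a , e∈φ = ⇒∈⋃ (matchingsIn S) e (φ a) (bwd ∈matchingsIn ((λ {x} → φ⊆S a x) , φ-perfect a)) e∈φ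

  matchingsIn-⋃ : ∀ {k} (U : SubsetFamily nE) → InducedCube G 𝓕 k U → matchingsIn (⋃ U) ≡ U
  matchingsIn-⋃ {k} U cube = family-ext (matchingsIn (⋃ U)) U to from
    where
      open ClarCoverOfCube U cube
      module C = MatchingsOfClarCover clarData
      to : ∀ N → N ∈ᶠ matchingsIn (⋃ U) → N ∈ᶠ U
      to N N∈ with fwd ∈matchingsIn N∈
      ... | N⊆⋃ , pmN = subst (_∈ᶠ U) (sym N≡ψa) (ψ∈U a)
        where
          a : Vec Bool k
          a = tabulate (λ i → lookup ψ₀ (C.e₀ i) xor lookup N (C.e₀ i))
          same₀ : ∀ i → lookup N (C.e₀ i) ≡ lookup (ψ a) (C.e₀ i)
          same₀ i = sym (trans (on-label (C.e₀ i) i (C.e₀-on i) a)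
                        (trans (cong (lookup ψ₀ (C.e₀ i) xor_) (VP.lookup∘tabulate _ i)) (xor-absorb (lookup ψ₀ (C.e₀ i)) _)))
          N≡ψa : N ≡ ψ a
          N≡ψa = C.determined-by-reference N (ψ a) pmN (λ e → N⊆⋃) (ψ-perfect a) (λ e → ⇒∈⋃ U e (ψ a) (ψ∈U a)) same₀
      from : ∀ N → N ∈ᶠ U → N ∈ᶠ matchingsIn (⋃ U)
      from N N∈U = bwd ∈matchingsIn ((λ {e} → ⇒∈⋃ U e N N∈U) , proj₁ cube N N∈U)

  ClarCover? : ∀ k S → Dec (ClarCover G 𝓕 k S)
  ClarCover? k S = SubP.anySubset? faces?
    where
      ⊥? : Dec ⊥
      ⊥? = no (λ ())
      ⇔? : ∀ {A B : Set} → Dec A → Dec B → Dec (A ⇔ B)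
      ⇔? a b = Dec.map′ (λ (to , from) → mk⇔ to from) (λ h → fwd h , bwd h) ((a Dec.→-dec b) Dec.×-dec (b Dec.→-dec a))
      disjoint? : ∀ K → Dec (∀ f h → f ∈ K → h ∈ K → f ≢ h → Disjoint f h)
      disjoint? K = FP.all? λ f → FP.all? λ h → (f SubP.∈? K) Dec.→-dec ((h SubP.∈? K) Dec.→-dec
                      (Dec.¬? (f FP.≟ h) Dec.→-dec FP.all? λ v → VOnFace? f v Dec.→-dec (VOnFace? h v Dec.→-dec ⊥?)))
      matching? : ∀ K M → Dec (
        (∀ e v → e ∈ M → Inc G e v → ∀ f → f ∈ K → VOnFace G f v → ⊥) ×
        (∀ v → (∃[ f ] (f ∈ K × VOnFace G f v))
               ⊎ UniquelyMatched M v) ×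
        (∀ e → (e ∈ S) ⇔ ((e ∈ M) ⊎ (∃[ f ] (f ∈ K × OnFace G f e)))))
      matching? K M =
        (FP.all? λ e → FP.all? λ v → (e SubP.∈? M) Dec.→-dec ((Inc? e v) Dec.→-dec
           FP.all? λ f → (f SubP.∈? K) Dec.→-dec (VOnFace? f v Dec.→-dec ⊥?)))
        Dec.×-dec
        (FP.all? λ v → FP.any? (λ f → (f SubP.∈? K) Dec.×-dec VOnFace? f v) Dec.⊎-dec
           FP.any? (λ e → (e SubP.∈? M) Dec.×-dec (Inc? e v Dec.×-dec
             FP.all? λ e′ → (e′ SubP.∈? M) Dec.→-dec (Inc? e′ v Dec.→-dec (e′ FP.≟ e)))))
        Dec.×-dec
        (FP.all? λ e → ⇔? (e SubP.∈? S) ((e SubP.∈? M) Dec.⊎-dec FP.any? (λ f → (f SubP.∈? K) Dec.×-dec OnFace? f e)))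
      faces? : ∀ K → Dec (K Sub.⊆ 𝓕 × Sub.∣ K ∣ ≡ k × (∀ f → f ∈ K → EvenFace G f) ×
                 (∀ f h → f ∈ K → h ∈ K → f ≢ h → Disjoint f h) × Σ (Subset nE) λ M → _)
      faces? K with K SubP.⊆? 𝓕
      ... | no K⊈𝓕 = no (λ r → K⊈𝓕 (proj₁ r))
      ... | yes K⊆𝓕 = Dec.map′ (λ (size , rest) → K⊆𝓕 , size , (λ f f∈K → even f (K⊆𝓕 f∈K)) , rest)
                                (λ (_ , size , _ , rest) → size , rest)
                                ((Sub.∣ K ∣ ℕ.≟ k) Dec.×-dec (disjoint? K Dec.×-dec SubP.anySubset? (matching? K)))

  -- The bijection S ↦ matchingsIn S, U ↦ ⋃ U.  Equalities proved under the
  -- irrelevant proofs are made relevant by decidability of equality.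
  clarCovers↔inducedCubes : ∀ k → ClarCovers G 𝓕 k ↔ InducedCubes G 𝓕 k
  clarCovers↔inducedCubes k = mk↔ₛ′ to from to∘from from∘to
    where
      to : ClarCovers G 𝓕 k → InducedCubes G 𝓕 k
      to (S , [ cc ]) = matchingsIn S , [ matchingsIn-cube (clarCover⇒clarData cc) ]
      from : InducedCubes G 𝓕 k → ClarCovers G 𝓕 k
      from (U , [ cube ]) = ⋃ U , [ clarData⇒clarCover (ClarCoverOfCube.clarData U cube) ]
      to∘from : ∀ y → to (from y) ≡ y
      to∘from (U , [ cube ]) = value-injective (recompute (family-≟ _ _) (matchingsIn-⋃ U cube))
      from∘to : ∀ x → from (to x) ≡ x
      from∘to (S , [ cc ]) = value-injective (recompute (VP.≡-dec B._≟_ _ _) (⋃-matchingsIn (clarCover⇒clarData cc)))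

theorem1p3 : (G : EmbeddedGraph) (𝓕 : Subset (EmbeddedGraph.nF G))
    → (∀ f → f ∈ 𝓕 → EvenFace G f)
    → 𝓕 ≢ ⊤
    → ∀ k → ∃[ a ] ((Fin a ↔ ClarCovers G 𝓕 k) × (Fin a ↔ InducedCubes G 𝓕 k))
theorem1p3 G 𝓕 even 𝓕≢⊤ k = size , count , FIP.↔-trans count (clarCovers↔inducedCubes k)
  where
    open Correspondence G 𝓕 even 𝓕≢⊤
    finite : ∃[ a ] (Fin a ↔ ClarCovers G 𝓕 k)
    finite = decidable-subsets-finite (ClarCover G 𝓕 k) (ClarCover? k)
    size : ℕ
    size = proj₁ finite
    count : Fin size ↔ ClarCovers G 𝓕 k
    count = proj₂ finite
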